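{- Let $q$ be a prime power with $q\equiv 5\pmod 8$, and let $\alpha$ be a primitive element of $\mathbb{F}_q$. Let $\gamma\in C_2^4$ and for $i\in\mathbb{F}_q^*$ define $D_i=\{i,\gamma i\}$. Let $\mathcal{D}=\{D_i:i\in C_0^4\}$. If $1-\gamma\notin C_0^2$, then $\mathcal{D}$ is a $(q,(q-1)/4,2,(q-5)/4)$-EDF and a $(q,(q-1)/4,2;0,1)$-DPDF.
   Context: For $e\mid q-1$, $C_i^e=\alpha^i\langle\alpha^e\rangle$, indices mod $e$; $C_0^2$ is the set of nonzero squares. $G=(\mathbb{F}_q,+)$, $G^*=\mathbb{F}_q^*$. $\Delta(D)=\{x-y:x\neq y\in D\}$ and $\Delta(D_1,D_2)=\{x-y:x\in D_1,y\in D_2\}$ (multisets). For a collection $\mathcal{D}$ of $m$ pairwise disjoint $k$-subsets $D_1,\ldots,D_m$ of $G^*$ ($n=|G|$), with $S=\bigcup_iD_i$: it is an $(n,m,k;\lambda,\mu)$-DPDF if $\sum_i\Delta(D_i)=\lambda S+\mu(G^*\setminus S)$; it is an $(n,m,k,\lambda)$-EDF if $\sum_{i\neq j}\Delta(D_i,D_j)=\lambda G^*$. -}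

module Defs where

open import Data.Nat as ℕ using (ℕ; zero; suc)
open import Data.Bool using (Bool; true; false; T; _∨_; _∧_; not; if_then_else_)
open import Data.Fin using (Fin)
open import Data.List using (List; map; filterᵇ; length; upTo; allFin)
open import Data.Nat.ListAction using (sum)
open import Data.Bool.ListAction using (any)
open import Data.Product using (Σ; _×_; _,_; ∃)
open import Relation.Nullary using (¬_; Dec; does)
open import Relation.Binary.PropositionalEquality using (_≡_; _≢_)
open import Relation.Binary.Definitions using (DecidableEquality)
open import Algebra.Structures using (IsCommutativeRing)
open import Function.Bundles using (_↔_; Inverse)

record FiniteField (q : ℕ) : Set₁ where
  infixl 6 _+_ _-_
  infixl 7 _*_
  field
    F        : Set
    _+_ _*_  : F → F → F
    -_       : F → F
    0# 1#    : F
    isCommutativeRing : IsCommutativeRing _≡_ _+_ _*_ -_ 0# 1#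
    0≢1      : 0# ≢ 1#
    inverse  : ∀ x → x ≢ 0# → Σ F λ y → x * y ≡ 1#
    enum     : Fin q ↔ F
    _≟_      : DecidableEquality F

  _-_ : F → F → F
  x - y = x + (- y)

  _^_ : F → ℕ → F
  x ^ zero  = 1#
  x ^ suc n = x * (x ^ n)

  elems : List F
  elems = map (Inverse.to enum) (allFin q)

  Subset : Set
  Subset = F → Bool

  _==_ : F → F → Bool
  x == y = does (x ≟ y)

  count : (F → Bool) → ℕ
  count p = length (filterᵇ p elems)

  sumOver : (F → ℕ) → ℕ
  sumOver f = sum (map f elems)

  count₂ : (F → F → Bool) → ℕ
  count₂ p = sumOver (λ x → count (p x))

  IsPrimitive : F → Set
  IsPrimitive α = ∀ x → x ≢ 0# → ∃ λ n → α ^ n ≡ x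

  -- Cyclotomic class C_i^e = α^i ⟨α^e⟩ = { α^(i + e j) : j ∈ ℕ }.
  -- Since α^e has order at most q - 1 < q, it suffices to take j < q.
  C : (α : F) (i e : ℕ) → Subset
  C α i e x = any (λ j → x == (α ^ (i ℕ.+ e ℕ.* j))) (upTo q)

  -- multiplicity of g in the multiset Δ(D) = { x - y : x ≠ y ∈ D }
  Δ : Subset → F → ℕ
  Δ D g = count₂ (λ x y → D x ∧ D y ∧ not (x == y) ∧ ((x - y) == g))

  -- multiplicity of g in the multiset Δ(D₁,D₂) = { x - y : x ∈ D₁ , y ∈ D₂ }
  Δ₂ : Subset → Subset → F → ℕ
  Δ₂ D₁ D₂ g = count₂ (λ x y → D₁ x ∧ D₂ y ∧ ((x - y) == g))

  -- A collection of blocks indexed by the elements of an index set I ⊆ F: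
  -- 𝒟 = { B i : i ∈ I }.  It is a collection of m pairwise disjoint k-subsets
  -- of G* = F* (pairwise disjointness of nonempty blocks makes i ↦ B i injective
  -- on I, so 𝒟 has exactly |I| members).
  record IsDisjointFamily (m k : ℕ) (I : Subset) (B : F → Subset) : Set where
    field
      size      : count I ≡ m
      blockSize : ∀ i → T (I i) → count (B i) ≡ k
      nonzero   : ∀ i → T (I i) → ¬ T (B i 0#)
      disjoint  : ∀ i j → T (I i) → T (I j) → i ≢ j →
                  ∀ x → ¬ (T (B i x) × T (B j x))

  union : Subset → (F → Subset) → Subset
  union I B x = any (λ i → I i ∧ B i x) elems

  sumIdx : Subset → (F → ℕ) → ℕ
  sumIdx I f = sumOver (λ i → if I i then f i else 0)

  IsDPDF : (n m k λ' μ : ℕ) (I : Subset) (B : F → Subset) → Set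
  IsDPDF n m k λ' μ I B =
    n ≡ q × IsDisjointFamily m k I B ×
    (∀ g → g ≢ 0# →
       (T (union I B g) → sumIdx I (λ i → Δ (B i) g) ≡ λ') ×
       (¬ T (union I B g) → sumIdx I (λ i → Δ (B i) g) ≡ μ))

  IsEDF : (n m k λ' : ℕ) (I : Subset) (B : F → Subset) → Set
  IsEDF n m k λ' I B =
    n ≡ q × IsDisjointFamily m k I B ×
    (∀ g → g ≢ 0# →
       sumIdx I (λ i → sumIdx I (λ j → if i == j then 0 else Δ₂ (B i) (B j) g)) ≡ λ')

{-# OPTIONS --safe #-}
module Submission where

-- Write S for the nonzero squares of 𝔽. Through the discrete logarithm to base α, the class of x ≠ 0
-- is dlog x mod 4; the four classes have (q - 1)/4 elements each, S = C₀⁴ ∪ C₂⁴, and -1 ∈ C₂⁴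
-- because q ≡ 5 (mod 8).
-- Since γ ∈ C₂⁴, the blocks {i, γi} with i ∈ C₀⁴ partition S: this gives disjointness and ⋃ Dᵢ = S.
-- For g ≠ 0, Δ(Dᵢ) contains g once for g = (1 - γ)i and once for g = -(1 - γ)i, so Σᵢ Δ(Dᵢ) contains
-- g once if g/(1 - γ) ∈ C₀⁴ ∪ C₂⁴ = S, that is if g ∉ S, and never otherwise: λ = 0 and μ = 1.
-- Summing Δ(Dᵢ, Dⱼ) over all pairs, diagonal included, counts the x ∈ S with x - g ∈ S, a cyclotomic
-- number of order 2: (q - 5)/4 if g ∈ S and (q - 1)/4 otherwise, by the classical linear relations
-- (row sums, x ↦ 1 - x, and x(x - 1) = x²(1 - x⁻¹)). Removing the diagonal leaves (q - 5)/4 in both cases.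

open import Defs

-- ℕ arithmetic is opened only inside this module, so that _*_ in the statement of mainTheorem18 is 𝔽's.
module _ where
  open import Algebra.Bundles using (CommutativeRing)
  import Algebra.Properties.Ring as RingProperties
  open import Data.Bool using (Bool; true; false; T; not; _∧_; _∨_; if_then_else_)
  import Data.Bool.Properties as Bool
  open import Data.Bool.Properties using (∨-zeroʳ; ∨-identityʳ; T-∨; T-≡)
  open import Data.Bool.ListAction using (any)
  open import Data.Empty using (⊥-elim)
  open import Data.Fin as Fin using (Fin; punchIn; toℕ; fromℕ<)
  open import Data.Fin.Permutation using (Permutation; permutation)
  open import Data.Fin.Properties using (punchInᵢ≢i; toℕ-injective; toℕ-fromℕ<; toℕ<n)
  open import Data.List using (List; []; _∷_; map; filterᵇ; length; tabulate; upTo)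
  open import Data.List.Membership.Propositional using (find; lose)
  open import Data.List.Membership.Propositional.Properties using (∈-upTo⁺)
  open import Data.List.Properties using (map-cong; map-tabulate)
  open import Data.List.Relation.Unary.Any.Properties using (any⁺; any⁻)
  open import Data.Nat as ℕ using (ℕ; zero; suc; _+_; _*_; _∸_; _≤_; _<_; z≤n; s≤s; _≡ᵇ_; _%_; _/_; NonZero)
  open import Data.Nat.DivMod using (m≡m%n+[m/n]*n; [m+kn]%n≡m%n; m<n⇒m%n≡m; m%n<n; m∣n⇒o%n%m≡o%m; m/n≤m; %-distribˡ-+; m*n/n≡m)
  open import Data.Nat.Divisibility using (_∣_; divides; ∣-trans)
  open import Data.Nat.ListAction using (sum)
  open import Data.Nat.Properties hiding (_≟_)
  open import Data.Nat.Solver using (module +-*-Solver)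
  open import Algebra.Properties.CommutativeSemigroup *-commutativeSemigroup using (x∙yz≈y∙xz)
  open import Algebra.Properties.Semiring.Sum +-*-semiring
    using (sum-syntax; sum-remove; ∑-distrib-+; ∑-comm; ∑-permute; *-distribˡ-sum; sum-cong-≗; sum-replicate-zero)
    renaming (sum to ∑)
  open import Data.Product using (∃; _×_; _,_; proj₁; proj₂)
  open import Data.Sum using (_⊎_; [_,_]′)
  open import Function using (_∘_; id; Inverse; Equivalence)
  open import Level using (0ℓ)
  open import Relation.Binary.Definitions using (tri<; tri≈; tri>)
  open import Relation.Binary.PropositionalEquality
  open import Relation.Nullary using (¬_; Dec; yes; no)
  open import Relation.Nullary.Decidable using (True; toWitness; dec-true; dec-false; T?; _→-dec_; _⊎-dec_; ¬?)
  open +-*-Solver using (solve; _:+_; _:*_; con; _:=_)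

  𝟙 : Bool → ℕ
  𝟙 true  = 1
  𝟙 false = 0

  𝟙≤1 : ∀ b → 𝟙 b ≤ 1
  𝟙≤1 true  = s≤s z≤n
  𝟙≤1 false = z≤n

  𝟙-∧ : ∀ a b → 𝟙 (a ∧ b) ≡ 𝟙 a * 𝟙 b
  𝟙-∧ true  b = sym (+-identityʳ (𝟙 b))
  𝟙-∧ false b = refl

  𝟙-∨ : ∀ {a b} → ¬ (T a × T b) → 𝟙 (a ∨ b) ≡ 𝟙 a + 𝟙 b
  𝟙-∨ {true}  {true}  ¬ab = ⊥-elim (¬ab _)
  𝟙-∨ {true}  {false} _   = refl
  𝟙-∨ {false}         _   = refl

  𝟙-not : ∀ b → 𝟙 (not b) + 𝟙 b ≡ 1
  𝟙-not true  = refl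
  𝟙-not false = refl

  T-ext : ∀ {a b} → (T a → T b) → (T b → T a) → a ≡ b
  T-ext {true}  {true}  _   _   = refl
  T-ext {true}  {false} a⇒b _   = ⊥-elim (a⇒b _)
  T-ext {false} {true}  _   b⇒a = ⊥-elim (b⇒a _)
  T-ext {false} {false} _   _   = refl

  𝟙-T : ∀ {b} → T b → 𝟙 b ≡ 1
  𝟙-T {true} _ = refl

  𝟙-¬T : ∀ {b} → ¬ T b → 𝟙 b ≡ 0
  𝟙-¬T {true}  ¬b = ⊥-elim (¬b _)
  𝟙-¬T {false} _  = refl

  𝟙*-cong : ∀ b {n n′} → (T b → n ≡ n′) → 𝟙 b * n ≡ 𝟙 b * n′
  𝟙*-cong true  n≡n′ = cong (1 *_) (n≡n′ _)
  𝟙*-cong false _    = refl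

  if-then-0 : ∀ b n → (if b then n else 0) ≡ 𝟙 b * n
  if-then-0 true  n = sym (+-identityʳ n)
  if-then-0 false n = refl

  any-𝟙 : ∀ {A : Set} (p : A → Bool) (xs : List A) {b} → sum (map (𝟙 ∘ p) xs) ≡ 𝟙 b → any p xs ≡ b
  any-𝟙 p []       {false} _ = refl
  any-𝟙 p []       {true}  ()
  any-𝟙 p (x ∷ xs) {b}     e with p x
  ... | false = any-𝟙 p xs e
  any-𝟙 p (x ∷ xs) {true}  e  | true = refl
  any-𝟙 p (x ∷ xs) {false} () | true

  firstBelow : ℕ → (ℕ → Bool) → ℕ
  firstBelow zero    p = 0
  firstBelow (suc n) p = if p 0 then 0 else suc (firstBelow n (p ∘ suc))

  firstBelow-least : ∀ n p {k} → k < n → T (p k) → T (p (firstBelow n p)) × firstBelow n p ≤ k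
  firstBelow-least (suc n) p {k} k<n pk with p 0 in p0
  ... | true = subst T (sym p0) _ , z≤n
  firstBelow-least (suc n) p {zero}  k<n pk | false rewrite p0 = ⊥-elim pk
  firstBelow-least (suc n) p {suc k} k<n pk | false =
    let (found , least) = firstBelow-least n (p ∘ suc) (≤-pred k<n) pk in found , s≤s least

  -- Finite case checks: the implicit argument reduces to ⊤ exactly when the decision procedure succeeds.
  module _ {P : ℕ → ℕ → Set} (P? : ∀ a b → Dec (P a b)) where
    decideBelow₂ : ∀ n → {True (allUpTo? (λ a → allUpTo? (P? a) n) n)} → ∀ a b → a < n → b < n → P a b
    decideBelow₂ n {t} a b a<n b<n = toWitness t a<n b<n

  module _ {P : ℕ → Set} (P? : ∀ a → Dec (P a)) where
    decideBelow₁ : ∀ n → {True (allUpTo? P? n)} → ∀ a → a < n → P a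
    decideBelow₁ n {t} a a<n = toWitness t a<n

  ∑-1 : ∀ n → ∑[ i < n ] 1 ≡ n
  ∑-1 zero    = refl
  ∑-1 (suc n) = cong suc (∑-1 n)

  ∑-0 : ∀ {n} (t : Fin n → ℕ) → (∀ i → t i ≡ 0) → ∑ t ≡ 0
  ∑-0 {n} t t≗0 = trans (sum-cong-≗ t≗0) (sum-replicate-zero n)

  ∑-point : ∀ {n} (t : Fin n → ℕ) i → (∀ j → j ≢ i → t j ≡ 0) → ∑ t ≡ t i
  ∑-point {suc n} t i off-i = begin
    ∑ t                    ≡⟨ sum-remove {i = i} t ⟩
    t i + ∑ (t ∘ punchIn i) ≡⟨ cong (t i +_) (∑-0 (t ∘ punchIn i) (λ j → off-i _ (punchInᵢ≢i i j))) ⟩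
    t i + 0                ≡⟨ +-identityʳ (t i) ⟩
    t i                    ∎
    where open ≡-Reasoning

  module FieldSums {q : ℕ} (𝔽 : FiniteField q) where
    open FiniteField 𝔽 renaming (_+_ to _⊕_; _*_ to _·_)
    open Inverse enum using (to; from; strictlyInverseˡ; strictlyInverseʳ)

    ==-refl : ∀ x → (x == x) ≡ true
    ==-refl x = dec-true (x ≟ x) refl

    ==-≢ : ∀ {x y} → x ≢ y → (x == y) ≡ false
    ==-≢ {x} {y} = dec-false (x ≟ y)

    ==⇒≡ : ∀ {x y} → T (x == y) → x ≡ y
    ==⇒≡ {x} {y} t with x ≟ y
    ... | yes x≡y = x≡y

    ≡⇒== : ∀ {x y} → x ≡ y → T (x == y)
    ≡⇒== {x} refl = subst T (sym (==-refl x)) _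

    ==-⇔ : ∀ {x y u v} → (x ≡ y → u ≡ v) → (u ≡ v → x ≡ y) → (x == y) ≡ (u == v)
    ==-⇔ x≡y⇒u≡v u≡v⇒x≡y = T-ext (≡⇒== ∘ x≡y⇒u≡v ∘ ==⇒≡) (≡⇒== ∘ u≡v⇒x≡y ∘ ==⇒≡)

    sumOver-∑ : ∀ f → sumOver f ≡ ∑[ i < q ] f (to i)
    sumOver-∑ f = trans (cong sum (trans (cong (map f) (map-tabulate (λ i → i) to)) (map-tabulate to f)))
                        (sum-tabulate (f ∘ to))
      where
      sum-tabulate : ∀ {n} (h : Fin n → ℕ) → sum (tabulate h) ≡ ∑ h
      sum-tabulate {zero}  h = refl
      sum-tabulate {suc n} h = cong (h Fin.zero +_) (sum-tabulate (h ∘ Fin.suc))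

    sumOver-cong : ∀ {f g} → (∀ x → f x ≡ g x) → sumOver f ≡ sumOver g
    sumOver-cong f≗g = cong sum (map-cong f≗g elems)

    sumOver-+ : ∀ f g → sumOver (λ x → f x + g x) ≡ sumOver f + sumOver g
    sumOver-+ f g = trans (sumOver-∑ _) (trans (∑-distrib-+ (f ∘ to) (g ∘ to))
                          (sym (cong₂ _+_ (sumOver-∑ f) (sumOver-∑ g))))

    sumOver-*ˡ : ∀ c f → c * sumOver f ≡ sumOver (λ x → c * f x)
    sumOver-*ˡ c f = trans (cong (c *_) (sumOver-∑ f)) (trans (*-distribˡ-sum c (f ∘ to)) (sym (sumOver-∑ _)))

    sumOver-∑-comm : ∀ {n} (f : F → Fin n → ℕ) →
                     sumOver (λ x → ∑[ i < n ] f x i) ≡ ∑[ i < n ] sumOver (λ x → f x i)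
    sumOver-∑-comm {n} f = trans (sumOver-∑ (λ x → ∑[ i < n ] f x i))
                                 (trans (∑-comm (f ∘ to)) (sum-cong-≗ (λ i → sym (sumOver-∑ (λ x → f x i)))))

    sumOver-comm : ∀ (f : F → F → ℕ) → sumOver (λ x → sumOver (f x)) ≡ sumOver (λ y → sumOver (λ x → f x y))
    sumOver-comm f = begin
      sumOver (λ x → sumOver (f x))                 ≡⟨ sumOver-cong (λ x → sumOver-∑ (f x)) ⟩
      sumOver (λ x → ∑[ j < q ] f x (to j))         ≡⟨ sumOver-∑-comm (λ x j → f x (to j)) ⟩
      ∑[ j < q ] sumOver (λ x → f x (to j))         ≡⟨ sumOver-∑ _ ⟨
      sumOver (λ y → sumOver (λ x → f x y))         ∎
      where open ≡-Reasoning

    sumOver-mono : ∀ {f g} → (∀ x → f x ≤ g x) → sumOver f ≤ sumOver g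
    sumOver-mono {f} {g} f≤g = go elems
      where
      go : ∀ xs → sum (map f xs) ≤ sum (map g xs)
      go []       = z≤n
      go (x ∷ xs) = +-mono-≤ (f≤g x) (go xs)

    sumOver-point : ∀ (f : F → ℕ) a → (∀ x → x ≢ a → f x ≡ 0) → sumOver f ≡ f a
    sumOver-point f a off-a = begin
      sumOver f              ≡⟨ sumOver-∑ f ⟩
      ∑[ i < q ] f (to i)    ≡⟨ ∑-point (f ∘ to) (from a) (λ i i≢ → off-a (to i) (i≢ ∘ from-injective i)) ⟩
      f (to (from a))        ≡⟨ cong f (strictlyInverseˡ a) ⟩
      f a                    ∎
      where
      open ≡-Reasoning
      from-injective : ∀ i → to i ≡ a → i ≡ from a
      from-injective i toi≡a = trans (sym (strictlyInverseʳ i)) (cong from toi≡a)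

    sumOver-unique : ∀ (f : F → ℕ) (p : F → Bool) a → (∀ x → T (p x) → x ≡ a) → T (p a) →
                     sumOver (λ x → f x * 𝟙 (p x)) ≡ f a
    sumOver-unique f p a unique pa =
      trans (sumOver-point (λ x → f x * 𝟙 (p x)) a off-a) (trans (cong (f a *_) (𝟙-T pa)) (*-identityʳ (f a)))
      where
      off-a : ∀ x → x ≢ a → f x * 𝟙 (p x) ≡ 0
      off-a x x≢a with p x in px
      ... | true  = ⊥-elim (x≢a (unique x (subst T (sym px) _)))
      ... | false = *-zeroʳ (f x)

    sumOver-reindex : ∀ (f : F → ℕ) (σ τ : F → F) → (∀ y → σ (τ y) ≡ y) → (∀ x → τ (σ x) ≡ x) →
                      sumOver (λ x → f (σ x)) ≡ sumOver f
    sumOver-reindex f σ τ στ τσ = begin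
      sumOver (f ∘ σ)                   ≡⟨ sumOver-∑ (f ∘ σ) ⟩
      ∑[ i < q ] f (σ (to i))           ≡⟨ sum-cong-≗ (λ i → cong f (strictlyInverseˡ (σ (to i)))) ⟨
      ∑[ i < q ] f (to (π⁺ i))          ≡⟨ ∑-permute (f ∘ to) π ⟨
      ∑[ i < q ] f (to i)               ≡⟨ sumOver-∑ f ⟨
      sumOver f                         ∎
      where
      open ≡-Reasoning
      π⁺ π⁻ : Fin q → Fin q
      π⁺ = from ∘ σ ∘ to
      π⁻ = from ∘ τ ∘ to
      π : Permutation q q
      π = permutation π⁺ π⁻
        (λ i → trans (cong (from ∘ σ) (strictlyInverseˡ (τ (to i)))) (trans (cong from (στ (to i))) (strictlyInverseʳ i)))
        (λ i → trans (cong (from ∘ τ) (strictlyInverseˡ (σ (to i)))) (trans (cong from (τσ (to i))) (strictlyInverseʳ i)))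

    sumOver-at : ∀ (f : F → ℕ) a → sumOver (λ x → f x * 𝟙 (x == a)) ≡ f a
    sumOver-at f a = sumOver-unique f (_== a) a (λ _ → ==⇒≡) (≡⇒== refl)

    count-𝟙 : ∀ p → count p ≡ sumOver (𝟙 ∘ p)
    count-𝟙 p = go elems
      where
      go : ∀ xs → length (filterᵇ p xs) ≡ sum (map (𝟙 ∘ p) xs)
      go []       = refl
      go (x ∷ xs) with p x
      ... | true  = cong suc (go xs)
      ... | false = go xs

    sumOver-1 : sumOver (λ _ → 1) ≡ q
    sumOver-1 = trans (sumOver-∑ _) (∑-1 q)

    sumOver-δ : ∀ a → sumOver (λ x → 𝟙 (x == a)) ≡ 1
    sumOver-δ a = trans (sumOver-cong (λ x → sym (*-identityˡ (𝟙 (x == a))))) (sumOver-at (λ _ → 1) a)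

    count-nonzero : sumOver (λ x → 𝟙 (not (x == 0#))) + 1 ≡ q
    count-nonzero = begin
      sumOver (λ x → 𝟙 (not (x == 0#))) + 1
        ≡⟨ cong (sumOver (λ x → 𝟙 (not (x == 0#))) +_) (sumOver-δ 0#) ⟨
      sumOver (λ x → 𝟙 (not (x == 0#))) + sumOver (λ x → 𝟙 (x == 0#))
        ≡⟨ sumOver-+ _ _ ⟨
      sumOver (λ x → 𝟙 (not (x == 0#)) + 𝟙 (x == 0#))
        ≡⟨ sumOver-cong (λ x → 𝟙-not (x == 0#)) ⟩
      sumOver (λ _ → 1)
        ≡⟨ sumOver-1 ⟩
      q ∎
      where open ≡-Reasoning

    sumOver-interchange : ∀ (c a : F → ℕ) (b : F → F → ℕ) →
      sumOver (λ j → c j * sumOver (λ x → a x * b j x)) ≡ sumOver (λ x → a x * sumOver (λ j → c j * b j x))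
    sumOver-interchange c a b = begin
      sumOver (λ j → c j * sumOver (λ x → a x * b j x))    ≡⟨ sumOver-cong (λ j → sumOver-*ˡ (c j) _) ⟩
      sumOver (λ j → sumOver (λ x → c j * (a x * b j x)))  ≡⟨ sumOver-comm _ ⟩
      sumOver (λ x → sumOver (λ j → c j * (a x * b j x)))  ≡⟨ sumOver-cong (λ x → sumOver-cong (λ j → x∙yz≈y∙xz (c j) (a x) (b j x))) ⟩
      sumOver (λ x → sumOver (λ j → a x * (c j * b j x)))  ≡⟨ sumOver-cong (λ x → sumOver-*ˡ (a x) _) ⟨
      sumOver (λ x → a x * sumOver (λ j → c j * b j x))    ∎
      where open ≡-Reasoning

    sumOver-pair-≤ : ∀ (f : F → ℕ) {a b} → a ≢ b → f a + f b ≤ sumOver f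
    sumOver-pair-≤ f {a} {b} a≢b = begin
      f a + f b                                                   ≡⟨ cong₂ _+_ (sumOver-at f a) (sumOver-at f b) ⟨
      sumOver (λ x → f x * 𝟙 (x == a)) + sumOver (λ x → f x * 𝟙 (x == b)) ≡⟨ sumOver-+ _ _ ⟨
      sumOver (λ x → f x * 𝟙 (x == a) + f x * 𝟙 (x == b))         ≡⟨ sumOver-cong (λ x → *-distribˡ-+ (f x) _ _) ⟨
      sumOver (λ x → f x * (𝟙 (x == a) + 𝟙 (x == b)))             ≤⟨ sumOver-mono (λ x → *-monoʳ-≤ (f x) (at-most-one x)) ⟩
      sumOver (λ x → f x * 1)                                     ≡⟨ sumOver-cong (λ x → *-identityʳ (f x)) ⟩
      sumOver f                                                   ∎
      where
      open ≤-Reasoning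
      at-most-one : ∀ x → 𝟙 (x == a) + 𝟙 (x == b) ≤ 1
      at-most-one x = subst (_≤ 1) (𝟙-∨ (λ (x≡a , x≡b) → a≢b (trans (sym (==⇒≡ x≡a)) (==⇒≡ x≡b)))) (𝟙≤1 _)

  module FieldAlgebra {q : ℕ} (𝔽 : FiniteField q) where
    open FiniteField 𝔽 renaming (_+_ to _⊕_; _*_ to _·_)
    open FieldSums 𝔽

    commutativeRing : CommutativeRing 0ℓ 0ℓ
    commutativeRing = record { isCommutativeRing = isCommutativeRing }

    module R = CommutativeRing commutativeRing
    module RP = RingProperties R.ring

    1≢0 : 1# ≢ 0#
    1≢0 = 0≢1 ∘ sym

    infix 8 _⁻¹
    _⁻¹ : F → F
    x ⁻¹ with x ≟ 0#
    ... | yes _   = 0#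
    ... | no x≢0 = proj₁ (inverse x x≢0)

    0⁻¹ : 0# ⁻¹ ≡ 0#
    0⁻¹ with 0# ≟ 0#
    ... | yes _   = refl
    ... | no 0≢0 = ⊥-elim (0≢0 refl)

    ⁻¹-inverseʳ : ∀ {x} → x ≢ 0# → x · x ⁻¹ ≡ 1#
    ⁻¹-inverseʳ {x} x≢0 with x ≟ 0#
    ... | yes x≡0  = ⊥-elim (x≢0 x≡0)
    ... | no x≢0′ = proj₂ (inverse x x≢0′)

    ⁻¹-inverseˡ : ∀ {x} → x ≢ 0# → x ⁻¹ · x ≡ 1#
    ⁻¹-inverseˡ x≢0 = trans (R.*-comm _ _) (⁻¹-inverseʳ x≢0)

    ⁻¹-·-cancel : ∀ {x} → x ≢ 0# → ∀ y → x ⁻¹ · (x · y) ≡ y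
    ⁻¹-·-cancel x≢0 y = trans (sym (R.*-assoc _ _ y)) (trans (cong (_· y) (⁻¹-inverseˡ x≢0)) (R.*-identityˡ y))

    ·-⁻¹-cancel : ∀ {x} → x ≢ 0# → ∀ y → x · (x ⁻¹ · y) ≡ y
    ·-⁻¹-cancel x≢0 y = trans (sym (R.*-assoc _ _ y)) (trans (cong (_· y) (⁻¹-inverseʳ x≢0)) (R.*-identityˡ y))

    ·-cancelˡ : ∀ {x a b} → x ≢ 0# → x · a ≡ x · b → a ≡ b
    ·-cancelˡ {x} {a} {b} x≢0 xa≡xb = begin
      a               ≡⟨ ⁻¹-·-cancel x≢0 a ⟨
      x ⁻¹ · (x · a)  ≡⟨ cong (x ⁻¹ ·_) xa≡xb ⟩
      x ⁻¹ · (x · b)  ≡⟨ ⁻¹-·-cancel x≢0 b ⟩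
      b               ∎
      where open ≡-Reasoning

    ·-≢0 : ∀ {x y} → x ≢ 0# → y ≢ 0# → x · y ≢ 0#
    ·-≢0 {x} x≢0 y≢0 xy≡0 = y≢0 (·-cancelˡ x≢0 (trans xy≡0 (sym (R.zeroʳ x))))

    ⁻¹-≢0 : ∀ {x} → x ≢ 0# → x ⁻¹ ≢ 0#
    ⁻¹-≢0 {x} x≢0 x⁻¹≡0 = 1≢0 (trans (sym (⁻¹-inverseʳ x≢0)) (trans (cong (x ·_) x⁻¹≡0) (R.zeroʳ x)))

    ⁻¹-involutive : ∀ x → x ⁻¹ ⁻¹ ≡ x
    ⁻¹-involutive x = by-cases (x ≟ 0#)
      where
      by-cases : Dec (x ≡ 0#) → x ⁻¹ ⁻¹ ≡ x
      by-cases (yes refl) = trans (cong _⁻¹ 0⁻¹) 0⁻¹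
      by-cases (no x≢0)  = ·-cancelˡ (⁻¹-≢0 x≢0) (trans (⁻¹-inverseʳ (⁻¹-≢0 x≢0)) (sym (⁻¹-inverseˡ x≢0)))

    ^-+ : ∀ x a b → x ^ (a + b) ≡ x ^ a · x ^ b
    ^-+ x zero    b = sym (R.*-identityˡ _)
    ^-+ x (suc a) b = trans (cong (x ·_) (^-+ x a b)) (sym (R.*-assoc _ _ _))

    ^-≢0 : ∀ {x} → x ≢ 0# → ∀ n → x ^ n ≢ 0#
    ^-≢0 x≢0 zero    = 1≢0
    ^-≢0 x≢0 (suc n) = ·-≢0 x≢0 (^-≢0 x≢0 n)

    ^-*-≡1 : ∀ {x d} → x ^ d ≡ 1# → ∀ k → x ^ (k * d) ≡ 1#
    ^-*-≡1         xᵈ≡1 zero    = refl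
    ^-*-≡1 {x} {d} xᵈ≡1 (suc k) = begin
      x ^ (d + k * d)       ≡⟨ ^-+ x d (k * d) ⟩
      x ^ d · x ^ (k * d)   ≡⟨ cong₂ _·_ xᵈ≡1 (^-*-≡1 xᵈ≡1 k) ⟩
      1# · 1#               ≡⟨ R.*-identityˡ 1# ⟩
      1#                    ∎
      where open ≡-Reasoning

    x-0≡x : ∀ x → x - 0# ≡ x
    x-0≡x x = trans (cong (x ⊕_) RP.-0#≈0#) (R.+-identityʳ x)

    x-[x-y]≡y : ∀ x y → x - (x - y) ≡ y
    x-[x-y]≡y x y = begin
      x ⊕ - (x - y)     ≡⟨ cong (x ⊕_) (RP.⁻¹-anti-homo‿- x y) ⟩
      x ⊕ (y - x)       ≡⟨ R.+-comm x (y - x) ⟩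
      (y ⊕ - x) ⊕ x     ≡⟨ R.+-assoc y (- x) x ⟩
      y ⊕ (- x ⊕ x)     ≡⟨ cong (y ⊕_) (R.-‿inverseˡ x) ⟩
      y ⊕ 0#            ≡⟨ R.+-identityʳ y ⟩
      y                 ∎
      where open ≡-Reasoning

    x-y≡z⇒x-z≡y : ∀ {x y z} → x - y ≡ z → x - z ≡ y
    x-y≡z⇒x-z≡y {x} {y} refl = x-[x-y]≡y x y

    [x-y==z]≡[x-z==y] : ∀ x y z → ((x - y) == z) ≡ ((x - z) == y)
    [x-y==z]≡[x-z==y] x y z = ==-⇔ x-y≡z⇒x-z≡y x-y≡z⇒x-z≡y

    1-x≡-1·[x-1] : ∀ x → 1# - x ≡ (- 1#) · (x - 1#)
    1-x≡-1·[x-1] x = sym (trans (RP.-1*x≈-x (x - 1#)) (RP.⁻¹-anti-homo‿- x 1#))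

    [1-x]-1≡-1·x : ∀ x → (1# - x) - 1# ≡ (- 1#) · x
    [1-x]-1≡-1·x x = begin
      (1# ⊕ - x) ⊕ - 1#    ≡⟨ cong (_⊕ - 1#) (R.+-comm 1# (- x)) ⟩
      (- x ⊕ 1#) ⊕ - 1#    ≡⟨ R.+-assoc (- x) 1# (- 1#) ⟩
      - x ⊕ (1# ⊕ - 1#)    ≡⟨ cong (- x ⊕_) (R.-‿inverseʳ 1#) ⟩
      - x ⊕ 0#             ≡⟨ R.+-identityʳ (- x) ⟩
      - x                  ≡⟨ RP.-1*x≈-x x ⟨
      (- 1#) · x           ∎
      where open ≡-Reasoning

    x·[y-1]≡x·y-x : ∀ x y → x · (y - 1#) ≡ x · y - x
    x·[y-1]≡x·y-x x y = trans (RP.x[y-z]≈xy-xz x y 1#) (cong (λ z → x · y - z) (R.*-identityʳ x))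

    x·[x-1]≡x²·[1-x⁻¹] : ∀ {x} → x ≢ 0# → x · (x - 1#) ≡ (x · x) · (1# - x ⁻¹)
    x·[x-1]≡x²·[1-x⁻¹] {x} x≢0 = begin
      x · (x - 1#)               ≡⟨ cong (λ z → x · (x - z)) (⁻¹-inverseʳ x≢0) ⟨
      x · (x - x · x ⁻¹)         ≡⟨ cong (λ z → x · (z - x · x ⁻¹)) (R.*-identityʳ x) ⟨
      x · (x · 1# - x · x ⁻¹)    ≡⟨ cong (x ·_) (RP.x[y-z]≈xy-xz x 1# (x ⁻¹)) ⟨
      x · (x · (1# - x ⁻¹))      ≡⟨ R.*-assoc x x _ ⟨
      (x · x) · (1# - x ⁻¹)      ∎
      where open ≡-Reasoning

    x-γ·x≡[1-γ]·x : ∀ γ x → x - γ · x ≡ (1# - γ) · x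
    x-γ·x≡[1-γ]·x γ x = sym (trans (RP.[y-z]x≈yx-zx x 1# γ) (cong (_- γ · x) (R.*-identityˡ x)))

    γ·x-x≡-[1-γ]·x : ∀ γ x → γ · x - x ≡ - ((1# - γ) · x)
    γ·x-x≡-[1-γ]·x γ x = trans (sym (RP.⁻¹-anti-homo‿- x (γ · x))) (cong -_ (x-γ·x≡[1-γ]·x γ x))

    sumOver-scale : ∀ (f : F → ℕ) {g} → g ≢ 0# → sumOver (λ y → f (g · y)) ≡ sumOver f
    sumOver-scale f g≢0 = sumOver-reindex f _ _ (·-⁻¹-cancel g≢0) (⁻¹-·-cancel g≢0)

  module PrimitiveElement {q : ℕ} (𝔽 : FiniteField q) (α : FiniteField.F 𝔽)
                          (α-primitive : FiniteField.IsPrimitive 𝔽 α) (2<q : 2 < q) where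
    open FiniteField 𝔽 renaming (_+_ to _⊕_; _*_ to _·_)
    open FieldSums 𝔽
    open FieldAlgebra 𝔽

    α≢0 : α ≢ 0#
    α≢0 α≡0 = <⇒≱ 2<q (begin
      q                                          ≡⟨ count-nonzero ⟨
      sumOver (λ x → 𝟙 (not (x == 0#))) + 1     ≤⟨ +-monoˡ-≤ 1 (sumOver-mono nonzero≤δ₁) ⟩
      sumOver (λ x → 𝟙 (x == 1#)) + 1           ≡⟨ cong (_+ 1) (sumOver-δ 1#) ⟩
      2                                          ∎)
      where
      open ≤-Reasoning
      nonzero≡1 : ∀ x → x ≢ 0# → x ≡ 1#
      nonzero≡1 x x≢0 with α-primitive x x≢0
      ... | zero  , 1≡x  = sym 1≡x
      ... | suc n , αⁿ⁺¹≡x = ⊥-elim (x≢0 (trans (sym αⁿ⁺¹≡x) (trans (cong (_· α ^ n) α≡0) (R.zeroˡ _))))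
      nonzero≤δ₁ : ∀ x → 𝟙 (not (x == 0#)) ≤ 𝟙 (x == 1#)
      nonzero≤δ₁ x with x ≟ 0#
      ... | yes _   = z≤n
      ... | no x≢0 rewrite nonzero≡1 x x≢0 | ==-refl 1# = ≤-refl

    private
      period : ∃ λ n → α ^ suc n ≡ 1#
      period with α-primitive (α ⁻¹) (⁻¹-≢0 α≢0)
      ... | n , αⁿ≡α⁻¹ = n , trans (cong (α ·_) αⁿ≡α⁻¹) (⁻¹-inverseʳ α≢0)

      isPeriod : ℕ → Bool
      isPeriod n = (α ^ suc n) == 1#

      order∸1 : ℕ
      order∸1 = firstBelow (suc (proj₁ period)) isPeriod

      order∸1-least : T (isPeriod order∸1) × order∸1 ≤ proj₁ period
      order∸1-least = firstBelow-least (suc (proj₁ period)) isPeriod ≤-refl (≡⇒== (proj₂ period))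

    order : ℕ
    order = suc order∸1

    α^order≡1 : α ^ order ≡ 1#
    α^order≡1 = ==⇒≡ (proj₁ order∸1-least)

    order-minimal : ∀ {k} → 0 < k → k < order → α ^ k ≢ 1#
    order-minimal {suc k} _ k<order αᵏ≡1 =
      <⇒≱ (≤-pred k<order) (proj₂ (firstBelow-least (suc (proj₁ period)) isPeriod k<bound (≡⇒== αᵏ≡1)))
      where
      k<bound : k < suc (proj₁ period)
      k<bound = m<n⇒m<1+n (<-≤-trans (≤-pred k<order) (proj₂ order∸1-least))

    private
      ^-injective-< : ∀ {i j} → i < j → j < order → α ^ i ≢ α ^ j
      ^-injective-< {i} {j} i<j j<o αⁱ≡αʲ =
        order-minimal (m<n⇒0<n∸m i<j) (≤-<-trans (m∸n≤m j i) j<o) (·-cancelˡ (^-≢0 α≢0 i) (begin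
          α ^ i · α ^ (j ∸ i)  ≡⟨ ^-+ α i (j ∸ i) ⟨
          α ^ (i + (j ∸ i))    ≡⟨ cong (α ^_) (m+[n∸m]≡n (<⇒≤ i<j)) ⟩
          α ^ j                ≡⟨ αⁱ≡αʲ ⟨
          α ^ i                ≡⟨ R.*-identityʳ _ ⟨
          α ^ i · 1#           ∎))
        where open ≡-Reasoning

    ^-injective : ∀ {i j} → i < order → j < order → α ^ i ≡ α ^ j → i ≡ j
    ^-injective {i} {j} i<o j<o αⁱ≡αʲ with <-cmp i j
    ... | tri< i<j _ _ = ⊥-elim (^-injective-< i<j j<o αⁱ≡αʲ)
    ... | tri≈ _ i≡j _ = i≡j
    ... | tri> _ _ j<i = ⊥-elim (^-injective-< j<i i<o (sym αⁱ≡αʲ))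

    ^-%order : ∀ n → α ^ n ≡ α ^ (n % order)
    ^-%order n = begin
      α ^ n                                       ≡⟨ cong (α ^_) (m≡m%n+[m/n]*n n order) ⟩
      α ^ (n % order + n / order * order)         ≡⟨ ^-+ α (n % order) _ ⟩
      α ^ (n % order) · α ^ (n / order * order)   ≡⟨ cong (α ^ (n % order) ·_) (^-*-≡1 α^order≡1 (n / order)) ⟩
      α ^ (n % order) · 1#                        ≡⟨ R.*-identityʳ _ ⟩
      α ^ (n % order)                             ∎
      where open ≡-Reasoning

    dlog : F → ℕ
    dlog x = firstBelow order (λ i → (α ^ i) == x)

    dlog-spec : ∀ {x} → x ≢ 0# → α ^ dlog x ≡ x × dlog x < order
    dlog-spec {x} x≢0 with α-primitive x x≢0
    ... | n , αⁿ≡x with firstBelow-least order (λ i → (α ^ i) == x) (m%n<n n order) (≡⇒== (trans (sym (^-%order n)) αⁿ≡x))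
    ... | found , first≤ = ==⇒≡ found , ≤-<-trans first≤ (m%n<n n order)

    dlog-^ : ∀ n → dlog (α ^ n) ≡ n % order
    dlog-^ n = ^-injective (proj₂ spec) (m%n<n n order) (trans (proj₁ spec) (^-%order n))
      where
      spec : α ^ dlog (α ^ n) ≡ α ^ n × dlog (α ^ n) < order
      spec = dlog-spec (^-≢0 α≢0 n)

    dlog-· : ∀ {x y} → x ≢ 0# → y ≢ 0# → dlog (x · y) ≡ (dlog x + dlog y) % order
    dlog-· {x} {y} x≢0 y≢0 = trans (cong dlog (sym αᵃ⁺ᵇ≡xy)) (dlog-^ (dlog x + dlog y))
      where
      αᵃ⁺ᵇ≡xy : α ^ (dlog x + dlog y) ≡ x · y
      αᵃ⁺ᵇ≡xy = trans (^-+ α (dlog x) (dlog y)) (cong₂ _·_ (proj₁ (dlog-spec x≢0)) (proj₁ (dlog-spec y≢0)))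

    private
      powers-cover : ∀ x → ∑[ i < order ] 𝟙 (x == (α ^ toℕ i)) ≡ 𝟙 (not (x == 0#))
      powers-cover x with x ≟ 0#
      ... | yes refl = ∑-0 {order} (λ i → 𝟙 (0# == (α ^ toℕ i)))
                         (λ i → cong 𝟙 (==-≢ (λ 0≡αⁱ → ^-≢0 α≢0 (toℕ i) (sym 0≡αⁱ))))
      ... | no x≢0  = trans (∑-point {order} (λ i → 𝟙 (x == (α ^ toℕ i))) i₀ off-i₀)
                            (cong 𝟙 (trans (cong (x ==_) αⁱ⁰≡x) (==-refl x)))
        where
        i₀ : Fin order
        i₀ = fromℕ< (proj₂ (dlog-spec x≢0))
        αⁱ⁰≡x : α ^ toℕ i₀ ≡ x
        αⁱ⁰≡x = trans (cong (α ^_) (toℕ-fromℕ< (proj₂ (dlog-spec x≢0)))) (proj₁ (dlog-spec x≢0))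
        off-i₀ : ∀ j → j ≢ i₀ → 𝟙 (x == (α ^ toℕ j)) ≡ 0
        off-i₀ j j≢i₀ = cong 𝟙 (==-≢ (λ x≡αʲ → j≢i₀ (toℕ-injective
          (^-injective (toℕ<n j) (toℕ<n i₀) (trans (sym x≡αʲ) (sym αⁱ⁰≡x))))))

    order+1≡q : order + 1 ≡ q
    order+1≡q = trans (cong (_+ 1) (sym nonzero≡order)) count-nonzero
      where
      open ≡-Reasoning
      nonzero≡order : sumOver (λ x → 𝟙 (not (x == 0#))) ≡ order
      nonzero≡order = begin
        sumOver (λ x → 𝟙 (not (x == 0#)))                  ≡⟨ sumOver-cong powers-cover ⟨
        sumOver (λ x → ∑[ i < order ] 𝟙 (x == (α ^ toℕ i)))  ≡⟨ sumOver-∑-comm {order} (λ x i → 𝟙 (x == (α ^ toℕ i))) ⟩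
        ∑[ i < order ] sumOver (λ x → 𝟙 (x == (α ^ toℕ i)))  ≡⟨ sum-cong-≗ {order} (λ i → sumOver-δ (α ^ toℕ i)) ⟩
        ∑[ i < order ] 1                                    ≡⟨ ∑-1 order ⟩
        order                                               ∎

    C-0 : ∀ {i e} → C α i e 0# ≡ false
    C-0 {i} {e} = T-ext zero∉C λ ()
      where
      zero∉C : T (C α i e 0#) → T false
      zero∉C 0∈C with find (any⁻ _ (upTo q) 0∈C)
      ... | j , _ , 0≡αⁱ⁺ᵉʲ = ^-≢0 α≢0 (i + e * j) (sym (==⇒≡ 0≡αⁱ⁺ᵉʲ))

    C-dlog : ∀ {i e} .{{_ : NonZero e}} → e ∣ order → i < e → ∀ {x} → x ≢ 0# → C α i e x ≡ (dlog x % e ≡ᵇ i)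
    C-dlog {i} {e} e∣order i<e {x} x≢0 = T-ext into out
      where
      open ≡-Reasoning
      into : T (C α i e x) → T (dlog x % e ≡ᵇ i)
      into x∈C with find (any⁻ _ (upTo q) x∈C)
      ... | j , _ , x≡αⁱ⁺ᵉʲ = ≡⇒≡ᵇ _ _ (begin
        dlog x % e                   ≡⟨ cong (λ y → dlog y % e) (==⇒≡ x≡αⁱ⁺ᵉʲ) ⟩
        dlog (α ^ (i + e * j)) % e   ≡⟨ cong (_% e) (dlog-^ (i + e * j)) ⟩
        (i + e * j) % order % e      ≡⟨ m∣n⇒o%n%m≡o%m e order (i + e * j) e∣order ⟩
        (i + e * j) % e              ≡⟨ cong (λ k → (i + k) % e) (*-comm e j) ⟩
        (i + j * e) % e              ≡⟨ [m+kn]%n≡m%n i j e ⟩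
        i % e                        ≡⟨ m<n⇒m%n≡m i<e ⟩
        i                            ∎)
      out : T (dlog x % e ≡ᵇ i) → T (C α i e x)
      out r = any⁺ _ (lose (∈-upTo⁺ j<q) (≡⇒== (sym αⁱ⁺ᵉʲ≡x)))
        where
        j : ℕ
        j = dlog x / e
        j<q : j < q
        j<q = ≤-<-trans (m/n≤m (dlog x) e) (<-≤-trans (proj₂ (dlog-spec x≢0)) (≤-trans (m≤m+n order 1) (≤-reflexive order+1≡q)))
        αⁱ⁺ᵉʲ≡x : α ^ (i + e * j) ≡ x
        αⁱ⁺ᵉʲ≡x = begin
          α ^ (i + e * j)             ≡⟨ cong (λ k → α ^ (k + e * j)) (≡ᵇ⇒≡ (dlog x % e) i r) ⟨
          α ^ (dlog x % e + e * j)    ≡⟨ cong (λ k → α ^ (dlog x % e + k)) (*-comm e j) ⟩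
          α ^ (dlog x % e + j * e)    ≡⟨ cong (α ^_) (m≡m%n+[m/n]*n (dlog x) e) ⟨
          α ^ dlog x                  ≡⟨ proj₁ (dlog-spec x≢0) ⟩
          x                           ∎

  _⊛_ : ℕ → ℕ → ℕ
  a ⊛ b = if (a ≡ᵇ 4) ∨ (b ≡ᵇ 4) then 4 else (a + b) % 4

  evenClass oddClass : ℕ → Bool
  evenClass a = (a ≡ᵇ 0) ∨ (a ≡ᵇ 2)
  oddClass  a = (a ≡ᵇ 1) ∨ (a ≡ᵇ 3)

  a⊛4≡4 : ∀ a → a ⊛ 4 ≡ 4
  a⊛4≡4 a = cong (if_then 4 else (a + 4) % 4) (∨-zeroʳ (a ≡ᵇ 4))

  a+a≡b+b⇒a≡b : ∀ {a b} → a + a ≡ b + b → a ≡ b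
  a+a≡b+b⇒a≡b {a} {b} e = *-cancelˡ-≡ a b 2 (trans (cong (a +_) (+-identityʳ a)) (trans e (sym (cong (b +_) (+-identityʳ b)))))

  cyclotomic-system : ∀ {ss sn ns nn n} → ss + sn + 1 ≡ n + n → ns + nn + 0 ≡ n + n → sn ≡ ns →
                      ss + nn + 1 ≡ n + n → nn ≡ n × ss + 1 ≡ n
  cyclotomic-system {ss} {sn} {ns} {nn} {n} row-sq row-nsq sn≡ns diag = nn≡n , ss+1≡n
    where
    sn≡nn : sn ≡ nn
    sn≡nn = +-cancelˡ-≡ ss sn nn (+-cancelʳ-≡ 1 (ss + sn) (ss + nn) (trans row-sq (sym diag)))
    nn≡n : nn ≡ n
    nn≡n = a+a≡b+b⇒a≡b (trans (cong (_+ nn) (trans (sym sn≡nn) sn≡ns)) (trans (sym (+-identityʳ (ns + nn))) row-nsq))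
    ss+1≡n : ss + 1 ≡ n
    ss+1≡n = +-cancelʳ-≡ n (ss + 1) n (begin
      ss + 1 + n    ≡⟨ +-assoc ss 1 n ⟩
      ss + (1 + n)  ≡⟨ cong (ss +_) (+-comm 1 n) ⟩
      ss + (n + 1)  ≡⟨ +-assoc ss n 1 ⟨
      ss + n + 1    ≡⟨ cong (λ k → ss + k + 1) nn≡n ⟨
      ss + nn + 1   ≡⟨ diag ⟩
      n + n         ∎)
      where open ≡-Reasoning

  module QuarticClasses {q : ℕ} (𝔽 : FiniteField q) (α : FiniteField.F 𝔽)
                        (α-primitive : FiniteField.IsPrimitive 𝔽 α)
                        (m : ℕ) (q≡4m+1 : q ≡ suc (m * 4)) (1≤m : 1 ≤ m) where
    open FiniteField 𝔽 renaming (_+_ to _⊕_; _*_ to _·_)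
    open FieldSums 𝔽
    open FieldAlgebra 𝔽

    2<q : 2 < q
    2<q = subst (2 <_) (sym q≡4m+1) (s≤s (≤-trans (s≤s (s≤s z≤n)) (*-monoˡ-≤ 4 1≤m)))

    open PrimitiveElement 𝔽 α α-primitive 2<q public

    order≡m*4 : order ≡ m * 4
    order≡m*4 = +-cancelʳ-≡ 1 order (m * 4) (trans order+1≡q (trans q≡4m+1 (+-comm 1 (m * 4))))

    4∣order : 4 ∣ order
    4∣order = divides m order≡m*4

    -- The class of x in 𝔽*/(𝔽*)⁴ ≅ ℤ/4, with 4 standing for x = 0, so that κ (x · y) ≡ κ x ⊛ κ y for all x, y.
    κ : F → ℕ
    κ x with x ≟ 0#
    ... | yes _ = 4
    ... | no _  = dlog x % 4

    κ<5 : ∀ x → κ x < 5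
    κ<5 x with x ≟ 0#
    ... | yes _ = ≤-refl
    ... | no _  = m<n⇒m<1+n (m%n<n (dlog x) 4)

    κ-0 : κ 0# ≡ 4
    κ-0 with 0# ≟ 0#
    ... | yes _   = refl
    ... | no 0≢0 = ⊥-elim (0≢0 refl)

    κ-≢0 : ∀ {x} → x ≢ 0# → κ x ≡ dlog x % 4
    κ-≢0 {x} x≢0 with x ≟ 0#
    ... | yes x≡0 = ⊥-elim (x≢0 x≡0)
    ... | no _    = refl

    κ≡4⇔0 : ∀ x → (κ x ≡ᵇ 4) ≡ (x == 0#)
    κ≡4⇔0 x with x ≟ 0#
    ... | yes _ = refl
    ... | no _  = decideBelow₁ (λ a → (a ≡ᵇ 4) Bool.≟ false) 4 (dlog x % 4) (m%n<n (dlog x) 4)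

    κ-class-≢0 : ∀ (P : ℕ → Bool) → P 4 ≡ false → ∀ {x} → T (P (κ x)) → x ≢ 0#
    κ-class-≢0 P P4≡false x∈P refl = subst T (trans (cong P κ-0) P4≡false) x∈P

    κ-^ : ∀ n → κ (α ^ n) ≡ n % 4
    κ-^ n = begin
      κ (α ^ n)               ≡⟨ κ-≢0 (^-≢0 α≢0 n) ⟩
      dlog (α ^ n) % 4        ≡⟨ cong (_% 4) (dlog-^ n) ⟩
      n % order % 4           ≡⟨ m∣n⇒o%n%m≡o%m 4 order n 4∣order ⟩
      n % 4                   ∎
      where open ≡-Reasoning

    κ-· : ∀ x y → κ (x · y) ≡ κ x ⊛ κ y
    κ-· x y with x ≟ 0# | y ≟ 0#
    ... | yes refl | _        = trans (cong κ (R.zeroˡ y)) κ-0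
    ... | no _     | yes refl = trans (cong κ (R.zeroʳ x)) (trans κ-0 (sym (a⊛4≡4 (dlog x % 4))))
    ... | no x≢0   | no y≢0   = begin
      κ (x · y)                                  ≡⟨ κ-≢0 (·-≢0 x≢0 y≢0) ⟩
      dlog (x · y) % 4                           ≡⟨ cong (_% 4) (dlog-· x≢0 y≢0) ⟩
      (dlog x + dlog y) % order % 4              ≡⟨ m∣n⇒o%n%m≡o%m 4 order (dlog x + dlog y) 4∣order ⟩
      (dlog x + dlog y) % 4                      ≡⟨ %-distribˡ-+ (dlog x) (dlog y) 4 ⟩
      (dlog x % 4 + dlog y % 4) % 4              ≡⟨ ⊛-<4 (dlog x % 4) (dlog y % 4) (m%n<n (dlog x) 4) (m%n<n (dlog y) 4) ⟨
      (dlog x % 4) ⊛ (dlog y % 4)                ∎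
      where
      open ≡-Reasoning
      ⊛-<4 : ∀ a b → a < 4 → b < 4 → a ⊛ b ≡ (a + b) % 4
      ⊛-<4 = decideBelow₂ (λ a b → a ⊛ b ℕ.≟ (a + b) % 4) 4

    C₄ : ℕ → Subset
    C₄ k x = κ x ≡ᵇ k

    Sq Nsq : Subset
    Sq  x = evenClass (κ x)
    Nsq x = oddClass (κ x)

    C-C₄ : ∀ {k} → k < 4 → ∀ x → C α k 4 x ≡ C₄ k x
    C-C₄ {k} k<4 x with x ≟ 0#
    ... | yes refl = trans (C-0 {k} {4}) (sym (decideBelow₁ (λ k → (4 ≡ᵇ k) Bool.≟ false) 4 k k<4))
    ... | no x≢0  = C-dlog 4∣order k<4 x≢0

    Sq⇒C₀² : ∀ {x} → T (Sq x) → T (C α 0 2 x)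
    Sq⇒C₀² {x} x∈Sq = subst T (sym (C-dlog (∣-trans (divides 2 refl) 4∣order) (s≤s z≤n) x≢0))
      (subst (λ a → T (a ≡ᵇ 0)) (m∣n⇒o%n%m≡o%m 2 4 (dlog x) (divides 2 refl))
        (subst (λ a → T (a % 2 ≡ᵇ 0)) (κ-≢0 x≢0)
          (decideBelow₁ (λ a → T? (evenClass a) →-dec T? (a % 2 ≡ᵇ 0)) 5 (κ x) (κ<5 x) x∈Sq)))
      where
      x≢0 : x ≢ 0#
      x≢0 = κ-class-≢0 evenClass refl x∈Sq

    κ-transfer : ∀ (R P Q : ℕ → Bool) →
                 {True (allUpTo? (λ a → allUpTo? (λ b → T? (R a) →-dec (P (a ⊛ b) Bool.≟ Q b)) 5) 5)} →
                 ∀ {g} → T (R (κ g)) → ∀ y → P (κ (g · y)) ≡ Q (κ y)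
    κ-transfer R P Q {table} {g} g∈R y = trans (cong P (κ-· g y))
      (decideBelow₂ (λ a b → T? (R a) →-dec (P (a ⊛ b) Bool.≟ Q b)) 5 {table} (κ g) (κ y) (κ<5 g) (κ<5 y) g∈R)

    ·square-Sq : ∀ {g} → T (Sq g) → ∀ y → Sq (g · y) ≡ Sq y
    ·square-Sq = κ-transfer evenClass evenClass evenClass

    ·square-Nsq : ∀ {g} → T (Sq g) → ∀ y → Nsq (g · y) ≡ Nsq y
    ·square-Nsq = κ-transfer evenClass oddClass oddClass

    ·nonsquare-Sq : ∀ {g} → T (Nsq g) → ∀ y → Sq (g · y) ≡ Nsq y
    ·nonsquare-Sq = κ-transfer oddClass evenClass oddClass

    ·nonsquare-Nsq : ∀ {g} → T (Nsq g) → ∀ y → Nsq (g · y) ≡ Sq y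
    ·nonsquare-Nsq = κ-transfer oddClass oddClass evenClass

    ·C₂-C₀ : ∀ {g} → T (C₄ 2 g) → ∀ y → C₄ 0 (g · y) ≡ C₄ 2 y
    ·C₂-C₀ = κ-transfer (_≡ᵇ 2) (_≡ᵇ 0) (_≡ᵇ 2)

    ·C₂-C₂ : ∀ {g} → T (C₄ 2 g) → ∀ y → C₄ 2 (g · y) ≡ C₄ 0 y
    ·C₂-C₂ = κ-transfer (_≡ᵇ 2) (_≡ᵇ 2) (_≡ᵇ 0)

    𝟙C₀+𝟙C₂≡𝟙Sq : ∀ x → 𝟙 (C₄ 0 x) + 𝟙 (C₄ 2 x) ≡ 𝟙 (Sq x)
    𝟙C₀+𝟙C₂≡𝟙Sq x = decideBelow₁ (λ a → 𝟙 (a ≡ᵇ 0) + 𝟙 (a ≡ᵇ 2) ℕ.≟ 𝟙 (evenClass a)) 5 (κ x) (κ<5 x)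

    𝟙Sq+𝟙Nsq+𝟙0≡1 : ∀ x → 𝟙 (Sq x) + 𝟙 (Nsq x) + 𝟙 (x == 0#) ≡ 1
    𝟙Sq+𝟙Nsq+𝟙0≡1 x = trans (cong (λ b → 𝟙 (Sq x) + 𝟙 (Nsq x) + 𝟙 b) (sym (κ≡4⇔0 x)))
      (decideBelow₁ (λ a → 𝟙 (evenClass a) + 𝟙 (oddClass a) + 𝟙 (a ≡ᵇ 4) ℕ.≟ 1) 5 (κ x) (κ<5 x))

    𝟙Sq·𝟙Sq+𝟙Nsq·𝟙Nsq≡𝟙Sq : ∀ x y → 𝟙 (Sq x) * 𝟙 (Sq y) + 𝟙 (Nsq x) * 𝟙 (Nsq y) ≡ 𝟙 (Sq (x · y))
    𝟙Sq·𝟙Sq+𝟙Nsq·𝟙Nsq≡𝟙Sq x y = trans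
      (decideBelow₂ (λ a b → 𝟙 (evenClass a) * 𝟙 (evenClass b) + 𝟙 (oddClass a) * 𝟙 (oddClass b) ℕ.≟ 𝟙 (evenClass (a ⊛ b)))
                    5 (κ x) (κ y) (κ<5 x) (κ<5 y))
      (cong (𝟙 ∘ evenClass) (sym (κ-· x y)))

    κ<4 : ∀ {x} → x ≢ 0# → κ x < 4
    κ<4 {x} x≢0 = subst (_< 4) (sym (κ-≢0 x≢0)) (m%n<n (dlog x) 4)

    x²∈Sq : ∀ {x} → x ≢ 0# → T (Sq (x · x))
    x²∈Sq {x} x≢0 = subst (T ∘ evenClass) (sym (κ-· x x)) (decideBelow₁ (λ a → T? (evenClass (a ⊛ a))) 4 (κ x) (κ<4 x≢0))

    Sq⊎Nsq : ∀ {x} → x ≢ 0# → T (Sq x) ⊎ T (Nsq x)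
    Sq⊎Nsq {x} x≢0 = decideBelow₁ (λ a → T? (evenClass a) ⊎-dec T? (oddClass a)) 4 (κ x) (κ<4 x≢0)

    Sq⇒¬Nsq : ∀ {x} → T (Sq x) → ¬ T (Nsq x)
    Sq⇒¬Nsq {x} = decideBelow₁ (λ a → T? (evenClass a) →-dec ¬? (T? (oddClass a))) 5 (κ x) (κ<5 x)

    Sq-0 : Sq 0# ≡ false
    Sq-0 = cong evenClass κ-0

    Sq-1 : Sq 1# ≡ true
    Sq-1 = cong evenClass (κ-^ 0)

    Nsq-1 : Nsq 1# ≡ false
    Nsq-1 = cong oddClass (κ-^ 0)

    α∈Nsq : T (Nsq α)
    α∈Nsq = subst (T ∘ oddClass) (sym (trans (cong κ (sym (R.*-identityʳ α))) (κ-^ 1))) _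

    α²∈C₂ : T (C₄ 2 (α · α))
    α²∈C₂ = subst (λ a → T (a ≡ᵇ 2)) (sym (trans (cong (λ z → κ (α · z)) (sym (R.*-identityʳ α))) (κ-^ 2))) _

    private
      2m+2m≡order : m + m + (m + m) ≡ order
      2m+2m≡order = trans (solve 1 (λ n → n :+ n :+ (n :+ n) := n :* con 4) refl m) (sym order≡m*4)

      β : F
      β = α ^ (m + m)

      β²≡1 : β · β ≡ 1#
      β²≡1 = trans (sym (^-+ α (m + m) (m + m))) (trans (cong (α ^_) 2m+2m≡order) α^order≡1)

      β≢1 : β ≢ 1#
      β≢1 = order-minimal 0<m+m (subst (m + m <_) 2m+2m≡order (m<m+n (m + m) 0<m+m))
        where
        0<m+m : 0 < m + m
        0<m+m = ≤-trans 1≤m (m≤m+n m m)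

    -- β² = 1 gives (β + 1) · β = β + 1, so β + 1 = 0 unless β = 1.
    -1≡α^[m+m] : - 1# ≡ α ^ (m + m)
    -1≡α^[m+m] with (β ⊕ 1#) ≟ 0#
    ... | yes β+1≡0 = sym (RP.+-inverseʳ-unique 1# β (trans (R.+-comm 1# β) β+1≡0))
    ... | no β+1≢0  = ⊥-elim (β≢1 (·-cancelˡ β+1≢0 (begin
      (β ⊕ 1#) · β       ≡⟨ R.distribʳ β β 1# ⟩
      β · β ⊕ 1# · β     ≡⟨ cong₂ _⊕_ β²≡1 (R.*-identityˡ β) ⟩
      1# ⊕ β             ≡⟨ R.+-comm 1# β ⟩
      β ⊕ 1#             ≡⟨ R.*-identityʳ (β ⊕ 1#) ⟨
      (β ⊕ 1#) · 1#      ∎)))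
      where open ≡-Reasoning

    -1∈Sq : T (Sq (- 1#))
    -1∈Sq = subst (T ∘ Sq) (sym (trans -1≡α^[m+m] (^-+ α m m))) (x²∈Sq (^-≢0 α≢0 m))

    -1∈C₂ : ∀ k → m ≡ suc (k * 2) → T (C₄ 2 (- 1#))
    -1∈C₂ k m≡2k+1 = subst (λ a → T (a ≡ᵇ 2)) (sym κ[-1]≡2) _
      where
      open ≡-Reasoning
      κ[-1]≡2 : κ (- 1#) ≡ 2
      κ[-1]≡2 = begin
        κ (- 1#)           ≡⟨ cong κ -1≡α^[m+m] ⟩
        κ (α ^ (m + m))    ≡⟨ κ-^ (m + m) ⟩
        (m + m) % 4        ≡⟨ cong (λ n → (n + n) % 4) m≡2k+1 ⟩
        (suc (k * 2) + suc (k * 2)) % 4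
          ≡⟨ cong (_% 4) (solve 1 (λ k → con 1 :+ k :* con 2 :+ (con 1 :+ k :* con 2) := con 2 :+ k :* con 4) refl k) ⟩
        (2 + k * 4) % 4    ≡⟨ [m+kn]%n≡m%n 2 k 4 ⟩
        2                  ∎

    infix 10 #_
    #_ : Subset → ℕ
    # P = sumOver (λ x → 𝟙 (P x))

    #Nsq≡#Sq : # Nsq ≡ # Sq
    #Nsq≡#Sq = trans (sym (sumOver-scale (𝟙 ∘ Nsq) α≢0)) (sumOver-cong (λ y → cong 𝟙 (·nonsquare-Nsq α∈Nsq y)))

    #Sq+#Nsq+1≡q : # Sq + # Nsq + 1 ≡ q
    #Sq+#Nsq+1≡q = begin
      # Sq + # Nsq + 1                                                  ≡⟨ cong (# Sq + # Nsq +_) (sumOver-δ 0#) ⟨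
      # Sq + # Nsq + sumOver (λ x → 𝟙 (x == 0#))                        ≡⟨ cong (_+ _) (sumOver-+ _ _) ⟨
      sumOver (λ x → 𝟙 (Sq x) + 𝟙 (Nsq x)) + sumOver (λ x → 𝟙 (x == 0#)) ≡⟨ sumOver-+ _ _ ⟨
      sumOver (λ x → 𝟙 (Sq x) + 𝟙 (Nsq x) + 𝟙 (x == 0#))                ≡⟨ sumOver-cong 𝟙Sq+𝟙Nsq+𝟙0≡1 ⟩
      sumOver (λ _ → 1)                                                 ≡⟨ sumOver-1 ⟩
      q                                                                 ∎
      where open ≡-Reasoning

    #Sq≡m+m : # Sq ≡ m + m
    #Sq≡m+m = a+a≡b+b⇒a≡b (+-cancelʳ-≡ 1 (# Sq + # Sq) (m + m + (m + m)) (begin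
      # Sq + # Sq + 1        ≡⟨ cong (λ n → # Sq + n + 1) #Nsq≡#Sq ⟨
      # Sq + # Nsq + 1       ≡⟨ #Sq+#Nsq+1≡q ⟩
      q                      ≡⟨ q≡4m+1 ⟩
      suc (m * 4)            ≡⟨ solve 1 (λ n → con 1 :+ n :* con 4 := n :+ n :+ (n :+ n) :+ con 1) refl m ⟩
      m + m + (m + m) + 1    ∎))
      where open ≡-Reasoning

    #Nsq≡m+m : # Nsq ≡ m + m
    #Nsq≡m+m = trans #Nsq≡#Sq #Sq≡m+m

    #C₀≡m : # C₄ 0 ≡ m
    #C₀≡m = a+a≡b+b⇒a≡b (begin
      # C₄ 0 + # C₄ 0      ≡⟨ cong (# C₄ 0 +_) #C₂≡#C₀ ⟨
      # C₄ 0 + # C₄ 2      ≡⟨ sumOver-+ _ _ ⟨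
      sumOver (λ x → 𝟙 (C₄ 0 x) + 𝟙 (C₄ 2 x)) ≡⟨ sumOver-cong 𝟙C₀+𝟙C₂≡𝟙Sq ⟩
      # Sq                 ≡⟨ #Sq≡m+m ⟩
      m + m                ∎)
      where
      open ≡-Reasoning
      #C₂≡#C₀ : # C₄ 2 ≡ # C₄ 0
      #C₂≡#C₀ = trans (sym (sumOver-scale (𝟙 ∘ C₄ 2) (·-≢0 α≢0 α≢0))) (sumOver-cong (λ y → cong 𝟙 (·C₂-C₂ α²∈C₂ y)))

    N[_,_] : Subset → Subset → F → ℕ
    N[ P , Q ] g = sumOver (λ x → 𝟙 (P x) * 𝟙 (Q (x - g)))

    N-row : ∀ P → N[ P , Sq ] 1# + N[ P , Nsq ] 1# + 𝟙 (P 1#) ≡ # P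
    N-row P = begin
      N[ P , Sq ] 1# + N[ P , Nsq ] 1# + 𝟙 (P 1#)
        ≡⟨ cong (N[ P , Sq ] 1# + N[ P , Nsq ] 1# +_) at-1 ⟨
      N[ P , Sq ] 1# + N[ P , Nsq ] 1# + sumOver (λ x → 𝟙 (P x) * 𝟙 ((x - 1#) == 0#))
        ≡⟨ cong (_+ _) (sumOver-+ _ _) ⟨
      sumOver (λ x → 𝟙 (P x) * 𝟙 (Sq (x - 1#)) + 𝟙 (P x) * 𝟙 (Nsq (x - 1#))) + sumOver (λ x → 𝟙 (P x) * 𝟙 ((x - 1#) == 0#))
        ≡⟨ sumOver-+ _ _ ⟨
      sumOver (λ x → 𝟙 (P x) * 𝟙 (Sq (x - 1#)) + 𝟙 (P x) * 𝟙 (Nsq (x - 1#)) + 𝟙 (P x) * 𝟙 ((x - 1#) == 0#))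
        ≡⟨ sumOver-cong (λ x → factor (𝟙 (P x)) (𝟙Sq+𝟙Nsq+𝟙0≡1 (x - 1#))) ⟩
      # P ∎
      where
      open ≡-Reasoning
      at-1 : sumOver (λ x → 𝟙 (P x) * 𝟙 ((x - 1#) == 0#)) ≡ 𝟙 (P 1#)
      at-1 = sumOver-unique (𝟙 ∘ P) (λ x → (x - 1#) == 0#) 1# (λ x → RP.x∙y⁻¹≈ε⇒x≈y x 1# ∘ ==⇒≡) (≡⇒== (R.-‿inverseʳ 1#))
      factor : ∀ p {s n z} → s + n + z ≡ 1 → p * s + p * n + p * z ≡ p
      factor p {s} {n} {z} s+n+z≡1 = begin
        p * s + p * n + p * z   ≡⟨ cong (_+ p * z) (*-distribˡ-+ p s n) ⟨
        p * (s + n) + p * z     ≡⟨ *-distribˡ-+ p (s + n) z ⟨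
        p * (s + n + z)         ≡⟨ cong (p *_) s+n+z≡1 ⟩
        p * 1                   ≡⟨ *-identityʳ p ⟩
        p                       ∎

    N[Sq,Nsq]≡N[Nsq,Sq] : N[ Sq , Nsq ] 1# ≡ N[ Nsq , Sq ] 1#
    N[Sq,Nsq]≡N[Nsq,Sq] = begin
      N[ Sq , Nsq ] 1#
        ≡⟨ sumOver-reindex (λ x → 𝟙 (Sq x) * 𝟙 (Nsq (x - 1#))) (λ x → 1# - x) (λ x → 1# - x) (x-[x-y]≡y 1#) (x-[x-y]≡y 1#) ⟨
      sumOver (λ x → 𝟙 (Sq (1# - x)) * 𝟙 (Nsq ((1# - x) - 1#)))
        ≡⟨ sumOver-cong (λ x → trans (cong₂ (λ a b → 𝟙 a * 𝟙 b) (Sq[1-x]≡Sq[x-1] x) (Nsq[[1-x]-1]≡Nsq[x] x))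
                                      (*-comm (𝟙 (Sq (x - 1#))) (𝟙 (Nsq x)))) ⟩
      N[ Nsq , Sq ] 1# ∎
      where
      open ≡-Reasoning
      Sq[1-x]≡Sq[x-1] : ∀ x → Sq (1# - x) ≡ Sq (x - 1#)
      Sq[1-x]≡Sq[x-1] x = trans (cong Sq (1-x≡-1·[x-1] x)) (·square-Sq -1∈Sq (x - 1#))
      Nsq[[1-x]-1]≡Nsq[x] : ∀ x → Nsq ((1# - x) - 1#) ≡ Nsq x
      Nsq[[1-x]-1]≡Nsq[x] x = trans (cong Nsq ([1-x]-1≡-1·x x)) (·square-Nsq -1∈Sq x)

    N[Sq,Sq]+N[Nsq,Nsq]+1≡#Sq : N[ Sq , Sq ] 1# + N[ Nsq , Nsq ] 1# + 1 ≡ # Sq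
    N[Sq,Sq]+N[Nsq,Nsq]+1≡#Sq = begin
      N[ Sq , Sq ] 1# + N[ Nsq , Nsq ] 1# + 1
        ≡⟨ cong₂ _+_ (sumOver-+ _ _) (sumOver-δ 0#) ⟨
      sumOver (λ x → 𝟙 (Sq x) * 𝟙 (Sq (x - 1#)) + 𝟙 (Nsq x) * 𝟙 (Nsq (x - 1#))) + sumOver (λ x → 𝟙 (x == 0#))
        ≡⟨ cong (_+ _) (sumOver-cong (λ x → 𝟙Sq·𝟙Sq+𝟙Nsq·𝟙Nsq≡𝟙Sq x (x - 1#))) ⟩
      sumOver (λ x → 𝟙 (Sq (x · (x - 1#)))) + sumOver (λ x → 𝟙 (x == 0#))
        ≡⟨ sumOver-+ _ _ ⟨
      sumOver (λ x → 𝟙 (Sq (x · (x - 1#))) + 𝟙 (x == 0#))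
        ≡⟨ sumOver-cong (λ x → shift x (x ≟ 0#)) ⟩
      sumOver (λ x → 𝟙 (Sq (1# - x ⁻¹)))
        ≡⟨ sumOver-reindex (𝟙 ∘ Sq) (λ x → 1# - x ⁻¹) (λ y → (1# - y) ⁻¹) σ∘τ τ∘σ ⟩
      # Sq ∎
      where
      open ≡-Reasoning
      σ∘τ : ∀ y → 1# - (1# - y) ⁻¹ ⁻¹ ≡ y
      σ∘τ y = trans (cong (λ x → 1# - x) (⁻¹-involutive (1# - y))) (x-[x-y]≡y 1# y)
      τ∘σ : ∀ x → (1# - (1# - x ⁻¹)) ⁻¹ ≡ x
      τ∘σ x = trans (cong _⁻¹ (x-[x-y]≡y 1# (x ⁻¹))) (⁻¹-involutive x)
      -- As 0⁻¹ = 0, the substitution x ↦ 1 - x⁻¹ sends 0 to the square 1: hence the term 𝟙 (x == 0#).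
      shift : ∀ x → Dec (x ≡ 0#) → 𝟙 (Sq (x · (x - 1#))) + 𝟙 (x == 0#) ≡ 𝟙 (Sq (1# - x ⁻¹))
      shift x (yes refl) = begin
        𝟙 (Sq (0# · (0# - 1#))) + 𝟙 (0# == 0#)  ≡⟨ cong₂ (λ a b → 𝟙 a + 𝟙 b) (trans (cong Sq (R.zeroˡ (0# - 1#))) Sq-0) (==-refl 0#) ⟩
        1                                       ≡⟨ cong 𝟙 Sq-1 ⟨
        𝟙 (Sq 1#)                               ≡⟨ cong (𝟙 ∘ Sq) (trans (cong (λ x → 1# - x) 0⁻¹) (x-0≡x 1#)) ⟨
        𝟙 (Sq (1# - 0# ⁻¹))                     ∎
      shift x (no x≢0) = begin
        𝟙 (Sq (x · (x - 1#))) + 𝟙 (x == 0#)     ≡⟨ cong₂ (λ a b → 𝟙 a + 𝟙 b) (cong Sq (x·[x-1]≡x²·[1-x⁻¹] x≢0)) (==-≢ x≢0) ⟩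
        𝟙 (Sq ((x · x) · (1# - x ⁻¹))) + 0      ≡⟨ +-identityʳ _ ⟩
        𝟙 (Sq ((x · x) · (1# - x ⁻¹)))          ≡⟨ cong 𝟙 (·square-Sq (x²∈Sq x≢0) (1# - x ⁻¹)) ⟩
        𝟙 (Sq (1# - x ⁻¹))                      ∎

    N[Nsq,Nsq]≡m×N[Sq,Sq]+1≡m : N[ Nsq , Nsq ] 1# ≡ m × N[ Sq , Sq ] 1# + 1 ≡ m
    N[Nsq,Nsq]≡m×N[Sq,Sq]+1≡m = cyclotomic-system
      (trans (cong (λ b → N[ Sq , Sq ] 1# + N[ Sq , Nsq ] 1# + 𝟙 b) (sym Sq-1)) (trans (N-row Sq) #Sq≡m+m))
      (trans (cong (λ b → N[ Nsq , Sq ] 1# + N[ Nsq , Nsq ] 1# + 𝟙 b) (sym Nsq-1)) (trans (N-row Nsq) #Nsq≡m+m))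
      N[Sq,Nsq]≡N[Nsq,Sq]
      (trans N[Sq,Sq]+N[Nsq,Nsq]+1≡#Sq #Sq≡m+m)

    N-scale : ∀ P Q {P′ Q′ g} → g ≢ 0# → (∀ y → P (g · y) ≡ P′ y) → (∀ y → Q (g · y) ≡ Q′ y) →
              N[ P , Q ] g ≡ N[ P′ , Q′ ] 1#
    N-scale P Q {P′} {Q′} {g} g≢0 P∘g Q∘g = begin
      N[ P , Q ] g                                          ≡⟨ sumOver-scale (λ x → 𝟙 (P x) * 𝟙 (Q (x - g))) g≢0 ⟨
      sumOver (λ x → 𝟙 (P (g · x)) * 𝟙 (Q (g · x - g)))    ≡⟨ sumOver-cong (λ x → cong₂ (λ a b → 𝟙 a * 𝟙 b) (P∘g x) (Q[gx-g]≡Q′[x-1] x)) ⟩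
      N[ P′ , Q′ ] 1#                                       ∎
      where
      open ≡-Reasoning
      Q[gx-g]≡Q′[x-1] : ∀ x → Q (g · x - g) ≡ Q′ (x - 1#)
      Q[gx-g]≡Q′[x-1] x = trans (cong Q (sym (x·[y-1]≡x·y-x g x))) (Q∘g (x - 1#))

    N[Sq,Sq]-square : ∀ {g} → T (Sq g) → N[ Sq , Sq ] g + 1 ≡ m
    N[Sq,Sq]-square g∈Sq = trans (cong (_+ 1) (N-scale Sq Sq (κ-class-≢0 evenClass refl g∈Sq) (·square-Sq g∈Sq) (·square-Sq g∈Sq)))
                                  (proj₂ N[Nsq,Nsq]≡m×N[Sq,Sq]+1≡m)

    N[Sq,Sq]-nonsquare : ∀ {g} → T (Nsq g) → N[ Sq , Sq ] g ≡ m
    N[Sq,Sq]-nonsquare g∈Nsq = trans (N-scale Sq Sq (κ-class-≢0 oddClass refl g∈Nsq) (·nonsquare-Sq g∈Nsq) (·nonsquare-Sq g∈Nsq))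
                                     (proj₁ N[Nsq,Nsq]≡m×N[Sq,Sq]+1≡m)

  module Differences {q : ℕ} (𝔽 : FiniteField q) where
    open FiniteField 𝔽 renaming (_+_ to _⊕_; _*_ to _·_)
    open FieldSums 𝔽
    open FieldAlgebra 𝔽

    Δ₂-translate : ∀ D₁ D₂ g → Δ₂ D₁ D₂ g ≡ sumOver (λ x → 𝟙 (D₁ x) * 𝟙 (D₂ (x - g)))
    Δ₂-translate D₁ D₂ g = sumOver-cong λ x → begin
      count (λ y → D₁ x ∧ D₂ y ∧ ((x - y) == g))
        ≡⟨ count-𝟙 _ ⟩
      sumOver (λ y → 𝟙 (D₁ x ∧ D₂ y ∧ ((x - y) == g)))
        ≡⟨ sumOver-cong (λ y → trans (𝟙-∧ (D₁ x) _) (cong (𝟙 (D₁ x) *_) (𝟙-∧ (D₂ y) _))) ⟩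
      sumOver (λ y → 𝟙 (D₁ x) * (𝟙 (D₂ y) * 𝟙 ((x - y) == g)))
        ≡⟨ sumOver-*ˡ (𝟙 (D₁ x)) _ ⟨
      𝟙 (D₁ x) * sumOver (λ y → 𝟙 (D₂ y) * 𝟙 ((x - y) == g))
        ≡⟨ cong (𝟙 (D₁ x) *_) (sumOver-unique (𝟙 ∘ D₂) (λ y → (x - y) == g) (x - g)
             (λ y x-y==g → sym (x-y≡z⇒x-z≡y (==⇒≡ x-y==g))) (≡⇒== (x-[x-y]≡y x g))) ⟩
      𝟙 (D₁ x) * 𝟙 (D₂ (x - g))
        ∎
      where open ≡-Reasoning

    Δ≡Δ₂ : ∀ D {g} → g ≢ 0# → Δ D g ≡ Δ₂ D D g
    Δ≡Δ₂ D {g} g≢0 = sumOver-cong λ x → trans (count-𝟙 _)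
      (trans (sumOver-cong (λ y → cong (λ b → 𝟙 (D x ∧ D y ∧ b)) (x≢y-redundant x y))) (sym (count-𝟙 _)))
      where
      x≢y-redundant : ∀ x y → not (x == y) ∧ ((x - y) == g) ≡ ((x - y) == g)
      x≢y-redundant x y with x ≟ y
      ... | yes refl = sym (==-≢ (λ x-x≡g → g≢0 (trans (sym x-x≡g) (R.-‿inverseʳ x))))
      ... | no _     = refl

    sumIdx-𝟙 : ∀ I f → sumIdx I f ≡ sumOver (λ i → 𝟙 (I i) * f i)
    sumIdx-𝟙 I f = sumOver-cong (λ i → if-then-0 (I i) (f i))

    sumIdx-off-diagonal : ∀ I (w : F → ℕ) {i} → T (I i) →
                          sumIdx I (λ j → if i == j then 0 else w j) + w i ≡ sumIdx I w
    sumIdx-off-diagonal I w {i} i∈I = begin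
      sumIdx I (λ j → if i == j then 0 else w j) + w i
        ≡⟨ cong (sumIdx I (λ j → if i == j then 0 else w j) +_) diagonal ⟨
      sumIdx I (λ j → if i == j then 0 else w j) + sumIdx I (λ j → if i == j then w j else 0)
        ≡⟨ sumOver-+ _ _ ⟨
      sumOver (λ j → (if I j then (if i == j then 0 else w j) else 0) + (if I j then (if i == j then w j else 0) else 0))
        ≡⟨ sumOver-cong (λ j → split (I j) (i == j) (w j)) ⟩
      sumIdx I w
        ∎
      where
      open ≡-Reasoning
      split : ∀ a b n → (if a then (if b then 0 else n) else 0) + (if a then (if b then n else 0) else 0) ≡ (if a then n else 0)
      split true  true  n = refl
      split true  false n = +-identityʳ n
      split false b     n = refl
      diagonal : sumIdx I (λ j → if i == j then w j else 0) ≡ w i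
      diagonal = trans (sumOver-point _ i off-i)
                       (cong₂ (λ a b → if a then (if b then w i else 0) else 0) (Equivalence.to T-≡ i∈I) (==-refl i))
        where
        off-i : ∀ j → j ≢ i → (if I j then (if i == j then w j else 0) else 0) ≡ 0
        off-i j j≢i rewrite ==-≢ (j≢i ∘ sym) with I j
        ... | true  = refl
        ... | false = refl

  quarters-of-8k+5 : ∀ {q k : ℕ} → q ≡ 5 + k * 8 → (q ∸ 1) / 4 ≡ suc (k * 2) × (q ∸ 5) / 4 ≡ k * 2
  quarters-of-8k+5 {k = k} refl =
      trans (cong (_/ 4) (solve 1 (λ k → con 4 :+ k :* con 8 := (con 1 :+ k :* con 2) :* con 4) refl k)) (m*n/n≡m (suc (k * 2)) 4)
    , trans (cong (_/ 4) (sym (*-assoc k 2 4))) (m*n/n≡m (k * 2) 4)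

  module Construction {q : ℕ} (𝔽 : FiniteField q) (α : FiniteField.F 𝔽)
                      (α-primitive : FiniteField.IsPrimitive 𝔽 α)
                      (q%8≡5 : q % 8 ≡ 5)
                      (γ : FiniteField.F 𝔽) (γ∈C₂ : T (FiniteField.C 𝔽 α 2 4 γ))
                      (1-γ∉C₀² : ¬ T (FiniteField.C 𝔽 α 0 2 (FiniteField._-_ 𝔽 (FiniteField.1# 𝔽) γ))) where
    open FiniteField 𝔽 renaming (_+_ to _⊕_; _*_ to _·_)
    open FieldSums 𝔽
    open FieldAlgebra 𝔽
    open Differences 𝔽

    k : ℕ
    k = q / 8

    q≡5+8k : q ≡ 5 + k * 8
    q≡5+8k = trans (m≡m%n+[m/n]*n q 8) (cong (_+ k * 8) q%8≡5)

    m : ℕ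
    m = suc (k * 2)

    q≡4m+1 : q ≡ suc (m * 4)
    q≡4m+1 = trans q≡5+8k (solve 1 (λ k → con 5 :+ k :* con 8 := con 1 :+ (con 1 :+ k :* con 2) :* con 4) refl k)

    open QuarticClasses 𝔽 α α-primitive m q≡4m+1 (s≤s z≤n)

    B : F → Subset
    B i x = (x == i) ∨ (x == (γ · i))

    c : F
    c = 1# - γ

    γ∈C₄2 : T (C₄ 2 γ)
    γ∈C₄2 = subst T (C-C₄ (s≤s (s≤s (s≤s z≤n))) γ) γ∈C₂

    γ≢0 : γ ≢ 0#
    γ≢0 = κ-class-≢0 (ℕ._≡ᵇ 2) refl γ∈C₄2

    γ≢1 : γ ≢ 1#
    γ≢1 γ≡1 = subst (λ a → T (a ℕ.≡ᵇ 2)) (κ-^ 0) (subst (T ∘ C₄ 2) γ≡1 γ∈C₄2)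

    c≢0 : c ≢ 0#
    c≢0 c≡0 = γ≢1 (sym (RP.x∙y⁻¹≈ε⇒x≈y 1# γ c≡0))

    c∈Nsq : T (Nsq c)
    c∈Nsq = [ (λ c∈Sq → ⊥-elim (1-γ∉C₀² (Sq⇒C₀² c∈Sq))) , id ]′ (Sq⊎Nsq c≢0)

    C₀⇒≢0 : ∀ {i} → T (C₄ 0 i) → i ≢ 0#
    C₀⇒≢0 = κ-class-≢0 (ℕ._≡ᵇ 0) refl

    I≡C₀ : ∀ i → C α 0 4 i ≡ C₄ 0 i
    I≡C₀ = C-C₄ (s≤s z≤n)

    sumIdx-I : ∀ f → sumIdx (C α 0 4) f ≡ sumOver (λ i → 𝟙 (C₄ 0 i) * f i)
    sumIdx-I f = trans (sumIdx-𝟙 (C α 0 4) f) (sumOver-cong (λ i → cong (λ b → 𝟙 b * f i) (I≡C₀ i)))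

    i≢γi : ∀ {i} → i ≢ 0# → i ≢ γ · i
    i≢γi {i} i≢0 i≡γi = γ≢1 (·-cancelˡ i≢0 (trans (R.*-comm i γ) (trans (sym i≡γi) (sym (R.*-identityʳ i)))))

    𝟙-B : ∀ {i} → i ≢ 0# → ∀ x → 𝟙 (B i x) ≡ 𝟙 (x == i) + 𝟙 (x == (γ · i))
    𝟙-B i≢0 x = 𝟙-∨ (λ (x≡i , x≡γi) → i≢γi i≢0 (trans (sym (==⇒≡ x≡i)) (==⇒≡ x≡γi)))

    sumOver-B : ∀ {i} → i ≢ 0# → ∀ (f : F → ℕ) → sumOver (λ x → 𝟙 (B i x) * f x) ≡ f i + f (γ · i)
    sumOver-B {i} i≢0 f = begin
      sumOver (λ x → 𝟙 (B i x) * f x)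
        ≡⟨ sumOver-cong (λ x → trans (*-comm (𝟙 (B i x)) (f x)) (trans (cong (f x *_) (𝟙-B i≢0 x)) (*-distribˡ-+ (f x) _ _))) ⟩
      sumOver (λ x → f x * 𝟙 (x == i) + f x * 𝟙 (x == (γ · i)))
        ≡⟨ sumOver-+ _ _ ⟩
      sumOver (λ x → f x * 𝟙 (x == i)) + sumOver (λ x → f x * 𝟙 (x == (γ · i)))
        ≡⟨ cong₂ _+_ (sumOver-at f i) (sumOver-at f (γ · i)) ⟩
      f i + f (γ · i)
        ∎
      where open ≡-Reasoning

    blocks-partition-Sq : ∀ x → sumOver (λ i → 𝟙 (C₄ 0 i) * 𝟙 (B i x)) ≡ 𝟙 (Sq x)
    blocks-partition-Sq x = begin
      sumOver (λ i → 𝟙 (C₄ 0 i) * 𝟙 (B i x))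
        ≡⟨ sumOver-cong (λ i → trans (𝟙*-cong (C₄ 0 i) (λ i∈C₀ → 𝟙-B (C₀⇒≢0 i∈C₀) x)) (*-distribˡ-+ (𝟙 (C₄ 0 i)) _ _)) ⟩
      sumOver (λ i → 𝟙 (C₄ 0 i) * 𝟙 (x == i) + 𝟙 (C₄ 0 i) * 𝟙 (x == (γ · i)))
        ≡⟨ sumOver-+ _ _ ⟩
      sumOver (λ i → 𝟙 (C₄ 0 i) * 𝟙 (x == i)) + sumOver (λ i → 𝟙 (C₄ 0 i) * 𝟙 (x == (γ · i)))
        ≡⟨ cong₂ _+_ (sumOver-unique (𝟙 ∘ C₄ 0) (x ==_) x (λ i x≡i → sym (==⇒≡ x≡i)) (≡⇒== refl))
                     (sumOver-unique (𝟙 ∘ C₄ 0) (λ i → x == (γ · i)) (γ ⁻¹ · x)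
                       (λ i x≡γi → trans (sym (⁻¹-·-cancel γ≢0 i)) (cong (γ ⁻¹ ·_) (sym (==⇒≡ x≡γi))))
                       (≡⇒== (sym (·-⁻¹-cancel γ≢0 x)))) ⟩
      𝟙 (C₄ 0 x) + 𝟙 (C₄ 0 (γ ⁻¹ · x))
        ≡⟨ cong (λ b → 𝟙 (C₄ 0 x) + 𝟙 b) (trans (sym (·C₂-C₂ γ∈C₄2 (γ ⁻¹ · x))) (cong (C₄ 2) (·-⁻¹-cancel γ≢0 x))) ⟩
      𝟙 (C₄ 0 x) + 𝟙 (C₄ 2 x)
        ≡⟨ 𝟙C₀+𝟙C₂≡𝟙Sq x ⟩
      𝟙 (Sq x)
        ∎
      where open ≡-Reasoning

    union≡Sq : ∀ x → union (C α 0 4) B x ≡ Sq x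
    union≡Sq x = any-𝟙 (λ i → C α 0 4 i ∧ B i x) elems
      (trans (sumOver-cong (λ i → trans (𝟙-∧ (C α 0 4 i) (B i x)) (cong (λ b → 𝟙 b * 𝟙 (B i x)) (I≡C₀ i)))) (blocks-partition-Sq x))

    family : IsDisjointFamily m 2 (C α 0 4) B
    family = record
      { size      = trans (count-𝟙 (C α 0 4)) (trans (sumOver-cong (cong 𝟙 ∘ I≡C₀)) #C₀≡m)
      ; blockSize = λ i i∈I → trans (count-𝟙 (B i))
                      (trans (sumOver-cong (λ x → sym (*-identityʳ (𝟙 (B i x))))) (sumOver-B (≢0 i∈I) (λ _ → 1)))
      ; nonzero   = λ i i∈I 0∈Bi →
                      [ ≢0 i∈I ∘ sym ∘ ==⇒≡ , ·-≢0 γ≢0 (≢0 i∈I) ∘ sym ∘ ==⇒≡ ]′ (Equivalence.to T-∨ 0∈Bi)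
      ; disjoint  = disjoint
      }
      where
      ≢0 : ∀ {i} → T (C α 0 4 i) → i ≢ 0#
      ≢0 {i} i∈I = C₀⇒≢0 (subst T (I≡C₀ i) i∈I)
      disjoint : ∀ i j → T (C α 0 4 i) → T (C α 0 4 j) → i ≢ j → ∀ x → ¬ (T (B i x) × T (B j x))
      disjoint i j i∈I j∈I i≢j x (x∈Bi , x∈Bj) = <⇒≱ (s≤s (s≤s z≤n)) (begin
        2                                                              ≡⟨ cong₂ _+_ (one i i∈I x∈Bi) (one j j∈I x∈Bj) ⟨
        𝟙 (C₄ 0 i) * 𝟙 (B i x) + 𝟙 (C₄ 0 j) * 𝟙 (B j x)               ≤⟨ sumOver-pair-≤ (λ k → 𝟙 (C₄ 0 k) * 𝟙 (B k x)) i≢j ⟩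
        sumOver (λ k → 𝟙 (C₄ 0 k) * 𝟙 (B k x))                        ≡⟨ blocks-partition-Sq x ⟩
        𝟙 (Sq x)                                                       ≤⟨ 𝟙≤1 (Sq x) ⟩
        1                                                              ∎)
        where
        open ≤-Reasoning
        one : ∀ k → T (C α 0 4 k) → T (B k x) → 𝟙 (C₄ 0 k) * 𝟙 (B k x) ≡ 1
        one k k∈I x∈Bk = cong₂ _*_ (𝟙-T (subst T (I≡C₀ k) k∈I)) (𝟙-T x∈Bk)

    Δ-B : ∀ {i g} → i ≢ 0# → g ≢ 0# → Δ (B i) g ≡ 𝟙 ((c · i) == g) + 𝟙 ((- (c · i)) == g)
    Δ-B {i} {g} i≢0 g≢0 = begin
      Δ (B i) g                                     ≡⟨ Δ≡Δ₂ (B i) g≢0 ⟩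
      Δ₂ (B i) (B i) g                              ≡⟨ Δ₂-translate (B i) (B i) g ⟩
      sumOver (λ x → 𝟙 (B i x) * 𝟙 (B i (x - g)))   ≡⟨ sumOver-B i≢0 (λ x → 𝟙 (B i (x - g))) ⟩
      𝟙 (B i (i - g)) + 𝟙 (B i (γ · i - g))         ≡⟨ cong₂ (λ a b → 𝟙 a + 𝟙 b) B[i-g] B[γi-g] ⟩
      𝟙 ((c · i) == g) + 𝟙 ((- (c · i)) == g)       ∎
      where
      open ≡-Reasoning
      x-x≢g : ∀ x → ((x - x) == g) ≡ false
      x-x≢g x = trans (cong (_== g) (R.-‿inverseʳ x)) (==-≢ (g≢0 ∘ sym))
      B[i-g] : B i (i - g) ≡ ((c · i) == g)
      B[i-g] = cong₂ _∨_ (trans ([x-y==z]≡[x-z==y] i g i) (x-x≢g i))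
                         (trans ([x-y==z]≡[x-z==y] i g (γ · i)) (cong (_== g) (x-γ·x≡[1-γ]·x γ i)))
      B[γi-g] : B i (γ · i - g) ≡ ((- (c · i)) == g)
      B[γi-g] = trans (cong₂ _∨_ (trans ([x-y==z]≡[x-z==y] (γ · i) g i) (cong (_== g) (γ·x-x≡-[1-γ]·x γ i)))
                                 (trans ([x-y==z]≡[x-z==y] (γ · i) g (γ · i)) (x-x≢g (γ · i))))
                      (∨-identityʳ _)

    sumIdx-Δ-B≡𝟙Nsq : ∀ {g} → g ≢ 0# → sumIdx (C α 0 4) (λ i → Δ (B i) g) ≡ 𝟙 (Nsq g)
    sumIdx-Δ-B≡𝟙Nsq {g} g≢0 = begin
      sumIdx (C α 0 4) (λ i → Δ (B i) g)
        ≡⟨ sumIdx-I _ ⟩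
      sumOver (λ i → 𝟙 (C₄ 0 i) * Δ (B i) g)
        ≡⟨ sumOver-cong (λ i → trans (𝟙*-cong (C₄ 0 i) (λ i∈C₀ → Δ-B (C₀⇒≢0 i∈C₀) g≢0)) (*-distribˡ-+ (𝟙 (C₄ 0 i)) _ _)) ⟩
      sumOver (λ i → 𝟙 (C₄ 0 i) * 𝟙 ((c · i) == g) + 𝟙 (C₄ 0 i) * 𝟙 ((- (c · i)) == g))
        ≡⟨ sumOver-+ _ _ ⟩
      sumOver (λ i → 𝟙 (C₄ 0 i) * 𝟙 ((c · i) == g)) + sumOver (λ i → 𝟙 (C₄ 0 i) * 𝟙 ((- (c · i)) == g))
        ≡⟨ cong₂ _+_ (sumOver-unique (𝟙 ∘ C₄ 0) (λ i → (c · i) == g) (c ⁻¹ · g) (λ i → solve-c ∘ ==⇒≡) (≡⇒== (·-⁻¹-cancel c≢0 g)))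
                     (sumOver-unique (𝟙 ∘ C₄ 0) (λ i → (- (c · i)) == g) (c ⁻¹ · (- g))
                       (λ i → solve-c ∘ negate ∘ ==⇒≡) (≡⇒== (trans (cong -_ (·-⁻¹-cancel c≢0 (- g))) (RP.-‿involutive g)))) ⟩
      𝟙 (C₄ 0 (c ⁻¹ · g)) + 𝟙 (C₄ 0 (c ⁻¹ · (- g)))
        ≡⟨ cong (λ b → 𝟙 (C₄ 0 (c ⁻¹ · g)) + 𝟙 b) C₀[c⁻¹·-g]≡C₂[c⁻¹·g] ⟩
      𝟙 (C₄ 0 (c ⁻¹ · g)) + 𝟙 (C₄ 2 (c ⁻¹ · g))
        ≡⟨ 𝟙C₀+𝟙C₂≡𝟙Sq (c ⁻¹ · g) ⟩
      𝟙 (Sq (c ⁻¹ · g))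
        ≡⟨ cong 𝟙 (trans (sym (·nonsquare-Nsq c∈Nsq (c ⁻¹ · g))) (cong Nsq (·-⁻¹-cancel c≢0 g))) ⟩
      𝟙 (Nsq g)
        ∎
      where
      open ≡-Reasoning
      solve-c : ∀ {i h} → c · i ≡ h → i ≡ c ⁻¹ · h
      solve-c {i} ci≡h = trans (sym (⁻¹-·-cancel c≢0 i)) (cong (c ⁻¹ ·_) ci≡h)
      negate : ∀ {x y} → - x ≡ y → x ≡ - y
      negate {x} -x≡y = trans (sym (RP.-‿involutive x)) (cong -_ -x≡y)
      C₀[c⁻¹·-g]≡C₂[c⁻¹·g] : C₄ 0 (c ⁻¹ · (- g)) ≡ C₄ 2 (c ⁻¹ · g)
      C₀[c⁻¹·-g]≡C₂[c⁻¹·g] = begin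
        C₄ 0 (c ⁻¹ · (- g))          ≡⟨ cong (C₄ 0) (RP.-‿distribʳ-* (c ⁻¹) g) ⟨
        C₄ 0 (- (c ⁻¹ · g))          ≡⟨ cong (C₄ 0) (RP.-1*x≈-x (c ⁻¹ · g)) ⟨
        C₄ 0 ((- 1#) · (c ⁻¹ · g))   ≡⟨ ·C₂-C₀ (-1∈C₂ k refl) (c ⁻¹ · g) ⟩
        C₄ 2 (c ⁻¹ · g)              ∎

    sumIdx-Δ₂-B≡N[Sq,Sq] : ∀ g → sumIdx (C α 0 4) (λ i → sumIdx (C α 0 4) (λ j → Δ₂ (B i) (B j) g)) ≡ N[ Sq , Sq ] g
    sumIdx-Δ₂-B≡N[Sq,Sq] g = begin
      sumIdx (C α 0 4) (λ i → sumIdx (C α 0 4) (λ j → Δ₂ (B i) (B j) g))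
        ≡⟨ trans (sumIdx-I _) (sumOver-cong (λ i → cong (𝟙 (C₄ 0 i) *_) (trans (sumIdx-I _) (inner i)))) ⟩
      sumOver (λ i → 𝟙 (C₄ 0 i) * sumOver (λ x → 𝟙 (B i x) * 𝟙 (Sq (x - g))))
        ≡⟨ sumOver-cong (λ i → cong (𝟙 (C₄ 0 i) *_) (sumOver-cong (λ x → *-comm (𝟙 (B i x)) _))) ⟩
      sumOver (λ i → 𝟙 (C₄ 0 i) * sumOver (λ x → 𝟙 (Sq (x - g)) * 𝟙 (B i x)))
        ≡⟨ sumOver-interchange (𝟙 ∘ C₄ 0) (λ x → 𝟙 (Sq (x - g))) (λ i x → 𝟙 (B i x)) ⟩
      sumOver (λ x → 𝟙 (Sq (x - g)) * sumOver (λ i → 𝟙 (C₄ 0 i) * 𝟙 (B i x)))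
        ≡⟨ sumOver-cong (λ x → trans (cong (𝟙 (Sq (x - g)) *_) (blocks-partition-Sq x)) (*-comm (𝟙 (Sq (x - g))) (𝟙 (Sq x)))) ⟩
      N[ Sq , Sq ] g
        ∎
      where
      open ≡-Reasoning
      inner : ∀ i → sumOver (λ j → 𝟙 (C₄ 0 j) * Δ₂ (B i) (B j) g) ≡ sumOver (λ x → 𝟙 (B i x) * 𝟙 (Sq (x - g)))
      inner i = begin
        sumOver (λ j → 𝟙 (C₄ 0 j) * Δ₂ (B i) (B j) g)
          ≡⟨ sumOver-cong (λ j → cong (𝟙 (C₄ 0 j) *_) (Δ₂-translate (B i) (B j) g)) ⟩
        sumOver (λ j → 𝟙 (C₄ 0 j) * sumOver (λ x → 𝟙 (B i x) * 𝟙 (B j (x - g))))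
          ≡⟨ sumOver-interchange (𝟙 ∘ C₄ 0) (𝟙 ∘ B i) (λ j x → 𝟙 (B j (x - g))) ⟩
        sumOver (λ x → 𝟙 (B i x) * sumOver (λ j → 𝟙 (C₄ 0 j) * 𝟙 (B j (x - g))))
          ≡⟨ sumOver-cong (λ x → cong (𝟙 (B i x) *_) (blocks-partition-Sq (x - g))) ⟩
        sumOver (λ x → 𝟙 (B i x) * 𝟙 (Sq (x - g)))
          ∎

    private
      if-+ : ∀ b {x y z} → (T b → x + y ≡ z) → (if b then x else 0) + (if b then y else 0) ≡ (if b then z else 0)
      if-+ true  x+y≡z = x+y≡z _
      if-+ false _     = refl

    off-diagonal-sum≡2k : ∀ {g} → g ≢ 0# →
                sumIdx (C α 0 4) (λ i → sumIdx (C α 0 4) (λ j → if i == j then 0 else Δ₂ (B i) (B j) g)) ≡ k * 2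
    off-diagonal-sum≡2k {g} g≢0 = [ square , nonsquare ]′ (Sq⊎Nsq g≢0)
      where
      open ≡-Reasoning
      I : Subset
      I = C α 0 4
      off-diagonal : F → ℕ
      off-diagonal i = sumIdx I (λ j → if i == j then 0 else Δ₂ (B i) (B j) g)
      E : ℕ
      E = sumIdx I off-diagonal
      E+V≡N : E + 𝟙 (Nsq g) ≡ N[ Sq , Sq ] g
      E+V≡N = begin
        E + 𝟙 (Nsq g)                                      ≡⟨ cong (E +_) (sumIdx-Δ-B≡𝟙Nsq g≢0) ⟨
        E + sumIdx I (λ i → Δ (B i) g)                      ≡⟨ sumOver-+ _ _ ⟨
        sumOver (λ i → (if I i then off-diagonal i else 0) + (if I i then Δ (B i) g else 0))
                                                            ≡⟨ sumOver-cong (λ i → if-+ (I i) (with-diagonal i)) ⟩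
        sumIdx I (λ i → sumIdx I (λ j → Δ₂ (B i) (B j) g))  ≡⟨ sumIdx-Δ₂-B≡N[Sq,Sq] g ⟩
        N[ Sq , Sq ] g                                      ∎
        where
        with-diagonal : ∀ i → T (I i) → off-diagonal i + Δ (B i) g ≡ sumIdx I (λ j → Δ₂ (B i) (B j) g)
        with-diagonal i i∈I = trans (cong (off-diagonal i +_) (Δ≡Δ₂ (B i) g≢0)) (sumIdx-off-diagonal I (λ j → Δ₂ (B i) (B j) g) i∈I)
      square : T (Sq g) → E ≡ k * 2
      square g∈Sq = trans (sym (+-identityʳ E)) (trans (cong (E +_) (sym (𝟙-¬T (Sq⇒¬Nsq g∈Sq))))
                      (trans E+V≡N (suc-injective (trans (+-comm 1 _) (N[Sq,Sq]-square g∈Sq)))))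
      nonsquare : T (Nsq g) → E ≡ k * 2
      nonsquare g∈Nsq = suc-injective (trans (+-comm 1 E) (trans (cong (E +_) (sym (𝟙-T g∈Nsq)))
                          (trans E+V≡N (N[Sq,Sq]-nonsquare g∈Nsq))))

    private
      quarters : (q ∸ 1) / 4 ≡ m × (q ∸ 5) / 4 ≡ k * 2
      quarters = quarters-of-8k+5 {q} {k} q≡5+8k

    isEDF : IsEDF q ((q ∸ 1) / 4) 2 ((q ∸ 5) / 4) (C α 0 4) B
    isEDF = subst₂ (λ n l → IsEDF q n 2 l (C α 0 4) B) (sym (proj₁ quarters)) (sym (proj₂ quarters))
                   (refl , family , λ g → off-diagonal-sum≡2k)

    isDPDF : IsDPDF q ((q ∸ 1) / 4) 2 0 1 (C α 0 4) B
    isDPDF = subst (λ n → IsDPDF q n 2 0 1 (C α 0 4) B) (sym (proj₁ quarters))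
                   (refl , family , λ g g≢0 → inside g≢0 , outside g≢0)
      where
      inside : ∀ {g} → g ≢ 0# → T (union (C α 0 4) B g) → sumIdx (C α 0 4) (λ i → Δ (B i) g) ≡ 0
      inside {g} g≢0 g∈S = trans (sumIdx-Δ-B≡𝟙Nsq g≢0) (𝟙-¬T (Sq⇒¬Nsq (subst T (union≡Sq g) g∈S)))
      outside : ∀ {g} → g ≢ 0# → ¬ T (union (C α 0 4) B g) → sumIdx (C α 0 4) (λ i → Δ (B i) g) ≡ 1
      outside {g} g≢0 g∉S = trans (sumIdx-Δ-B≡𝟙Nsq g≢0) (𝟙-T ([ Sq-impossible , id ]′ (Sq⊎Nsq g≢0)))
        where
        Sq-impossible : T (Sq g) → T (Nsq g)
        Sq-impossible g∈Sq = ⊥-elim (g∉S (subst T (sym (union≡Sq g)) g∈Sq))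

open import Data.Bool using (T; _∨_)
open import Data.Nat using (ℕ; _^_; _%_; _/_; _∸_; _≥_)
open import Data.Nat.Primality using (Prime)
open import Data.Product using (∃; _×_; _,_)
open import Relation.Binary.PropositionalEquality using (_≡_)
open import Relation.Nullary using (¬_)

mainTheorem18 : (q : ℕ) → (∃ λ p → ∃ λ r → Prime p × r ≥ 1 × q ≡ p ^ r) → q % 8 ≡ 5 →
    (𝔽 : FiniteField q) → let open FiniteField 𝔽 in
    (α : F) → IsPrimitive α → (γ : F) → T (C α 2 4 γ) →
    ¬ T (C α 0 2 (1# - γ)) →
    IsEDF q ((q ∸ 1) / 4) 2 ((q ∸ 5) / 4) (C α 0 4) (λ i x → (x == i) ∨ (x == (γ * i))) ×
    IsDPDF q ((q ∸ 1) / 4) 2 0 1 (C α 0 4) (λ i x → (x == i) ∨ (x == (γ * i)))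
mainTheorem18 q _ q%8≡5 𝔽 α α-primitive γ γ∈C₂ 1-γ∉C₀² = isEDF , isDPDF
  where open Construction 𝔽 α α-primitive q%8≡5 γ γ∈C₂ 1-γ∉C₀²
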